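{- Let $t,\ell,\lambda$ be integers with $t>\ell\ge0$, $\lambda\ge1$, and let $\rho$ be a fixed positive integer. There exists $M$ such that for $m\ge M$ the following holds. Let $A$ be an $m$-rowed $(0,1)$-matrix with $(\lambda+2)\cdot{\bf 1}_t{\bf 0}_\ell\not\prec A$, all column sums in $\{t,\dots,m-\ell\}$, no repeated column of column sum $t$, and more than $\left(1+\frac{\lambda}{t+1}\right)\binom{m}{t}$ columns. Let $R\subseteq[m]$ with $|R|=\rho$, let ${\cal A}^R_{t+1}$ be the multiset of $(t+1)$-sets $I(\alpha)$ over columns $\alpha$ of $A$ of column sum $t+1$ having a $1$ in some row of $R$, let $$W_R=\Big\{S\in\binom{[m]}{t}:\exists x\in[m]\text{ with }S\cup\{x\}\in{\cal A}^R_{t+1}\Big\},$$ and let $Z_R=Y\setminus W_R$, where $Y=\{S\in\binom{[m]}{t}: d(S)=\lambda,\ \mu(S)=1\}$. Then $|Z_R|>0$.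
   Context: For a column $\alpha$, $I(\alpha)$ is the set of rows where $\alpha$ has a $1$. ${\cal A}_t$ is the set of $I(\alpha)$ over columns of $A$ of sum $t$, ${\cal A}_{t+1}$ the multiset of $I(\alpha)$ over columns of sum $t+1$. For $S\in\binom{[m]}{t}$, $\mu(S)=1$ if $S\in{\cal A}_t$ and $0$ otherwise; $d(S)$ is the number of members of ${\cal A}_{t+1}$ (with multiplicity) containing $S$. ${\bf 1}_t{\bf 0}_\ell$ is the column of $t$ ones above $\ell$ zeros, $q\cdot{\bf v}$ is $q$ copies of ${\bf v}$, and $F\prec A$ means some submatrix of $A$ is a row and column permutation of $F$. -}

module Defs where

open import Data.Bool using (Bool; true; false)
open import Data.Nat using (ℕ; suc; _+_; _*_; _∸_; _≤_; _<_; _<ᵇ_)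
import Data.Nat as ℕ
open import Data.Nat.Combinatorics using (_C_)
open import Data.Fin using (Fin; toℕ)
open import Data.Fin.Subset using (Subset; ∣_∣; _⊆_; _∪_; ⁅_⁆; _∈_; _∉_)
open import Data.Fin.Subset.Properties using (_⊆?_)
open import Data.Vec using (tabulate; allFin; count)
open import Data.Product using (Σ; ∃; _×_; _,_)
open import Data.Product.Relation.Unary.All using () 
open import Relation.Nullary using (¬_)
open import Relation.Nullary.Decidable using (_×-dec_)
open import Relation.Binary.PropositionalEquality using (_≡_; _≢_)
open import Function.Definitions using (Injective)

Matrix : ℕ → ℕ → Set
Matrix m n = Fin m → Fin n → Bool

I : ∀ {m n} → Matrix m n → Fin n → Subset m
I A j = tabulate (λ i → A i j)

colSum : ∀ {m n} → Matrix m n → Fin n → ℕ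
colSum A j = ∣ I A j ∣

-- F ≺ A : some submatrix of A (choice of distinct rows and distinct columns,
-- in any order) equals F entrywise; this is exactly "a row and column
-- permutation of F is a submatrix of A".
_≺_ : ∀ {p q m n} → Matrix p q → Matrix m n → Set
_≺_ {p} {q} {m} {n} F A =
  Σ (Fin p → Fin m) λ r → Σ (Fin q → Fin n) λ c →
    Injective _≡_ _≡_ r × Injective _≡_ _≡_ c ×
    (∀ i j → A (r i) (c j) ≡ F i j)

-- q · (1_t 0_ℓ): q copies of the column of t ones above ℓ zeros.
copies1t0l : (q t ℓ : ℕ) → Matrix (t + ℓ) q
copies1t0l q t ℓ i j = toℕ i <ᵇ t

μ1 : ∀ {m n} → Matrix m n → ℕ → Subset m → Set
μ1 A t S = ∃ λ j → colSum A j ≡ t × I A j ≡ S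

d : ∀ {m n} → Matrix m n → ℕ → Subset m → ℕ
d A t S = count (λ j → (colSum A j ℕ.≟ suc t) ×-dec (S ⊆? I A j)) (allFin _)

InY : ∀ {m n} → Matrix m n → ℕ → ℕ → Subset m → Set
InY A t lam S = ∣ S ∣ ≡ t × d A t S ≡ lam × μ1 A t S

InW : ∀ {m n} → Matrix m n → ℕ → Subset m → Subset m → Set
InW {m} A t R S = ∣ S ∣ ≡ t × Σ (Fin m) λ x → ∃ λ j →
  colSum A j ≡ suc t × (∃ λ r → r ∈ R × A r j ≡ true) × S ∪ ⁅ x ⁆ ≡ I A j

module Submission where

-- Sort the columns by size k: k = t, k = t + 1, t + 2 ≤ k ≤ K, and k > K (heavy).
-- Forbidding (λ+2)·1_t0_ℓ means that a t-set S lies in at most λ+1 columns of size ≤ K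
-- (λ+2 of them would leave ℓ rows outside their union), and that a t-set S together with
-- an ℓ-set L lies in at most λ+1 columns containing S and avoiding L. Double counting
-- incidences between t-sets and columns, the lower bound on the number of columns forces
-- all but fewer than C(m,t)/2 of the t-sets S to have μ(S) = 1 and d(S) = λ; the heavy
-- columns are few because each of them accounts for at least c₀·C(m,ℓ) pairs (S, L).
-- Each row lies in at most (λ+1)·C(m−1,t−1) columns of sum t+1, so |W_R| ≤ C(m,t)/2
-- once m is large, and some S ∈ Y avoids W_R.

open import Defs
open import Data.Bool using (Bool; true; false; not; _∧_; _∨_; T)
open import Data.Bool.Properties using (T-∧)
open import Data.Empty using (⊥)
open import Data.Fin using (Fin; zero; suc; toℕ; fromℕ<; splitAt; join)
open import Data.Fin.Properties using (join-splitAt) renaming (suc-injective to Fin-suc-injective)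
open import Data.Fin.Subset using (Subset; ∣_∣; _⊆_; _∈_; ⊤; ∁; _∪_; ⁅_⁆) renaming (⊥ to ∅)
open import Data.Fin.Subset.Properties
  using ( _⊆?_; _∈?_; ⊆⊤; ∈⊤; ⊥⊆; p⊆p∪q; q⊆p∪q; drop-∷-⊆; x∈∁p⇒x∉p; p⊆q⇒∁p⊇∁q
        ; ∣⊤∣≡n; ∣⊥∣≡0; ∣p∣≤∣x∷p∣; ∣∁p∣≡n∸∣p∣; p⊆q⇒∣p∣≤∣q∣ )
open import Data.Nat
open import Data.Nat.Properties
open import Algebra.Properties.CommutativeSemigroup +-commutativeSemigroup
  using () renaming (interchange to +-interchange)
open import Data.Nat.Combinatorics using (_C_; nCk+nC[k+1]≡[n+1]C[k+1]; nC1≡n; nCn≡1; nCk≡nC[n∸k])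
open import Data.Nat.Tactic.RingSolver using (solve-∀)
open import Data.Product using (Σ; ∃; _×_; _,_; proj₁; proj₂)
open import Data.Sum using (inj₁; inj₂; [_,_]′)
open import Data.Unit using (tt)
open import Data.Vec.Base using ([]; _∷_; here; there; tabulate; count)
open import Data.Vec.Properties using (lookup∘tabulate; []=⇒lookup; lookup⇒[]=)
open import Function using (_∘_)
open import Function.Bundles using (Equivalence)
open import Function.Definitions using (Injective)
open import Relation.Nullary using (¬_; Dec; yes; no; does; contradiction)
open import Relation.Nullary.Decidable using (dec-true)
open import Relation.Binary.PropositionalEquality

ind : Bool → ℕ
ind true = 1
ind false = 0

ind-∧ : ∀ a b → ind (a ∧ b) ≡ ind a * ind b
ind-∧ true b = sym (+-identityʳ (ind b))
ind-∧ false b = refl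

ind-+-not : ∀ a → ind a + ind (not a) ≡ 1
ind-+-not true = refl
ind-+-not false = refl

ind-∧-*-≤ : ∀ a b c → ind (a ∧ b) * ind c ≤ ind (a ∧ c)
ind-∧-*-≤ true true c = ≤-reflexive (+-identityʳ (ind c))
ind-∧-*-≤ true false c = z≤n
ind-∧-*-≤ false b c = z≤n

T-from-≡ : ∀ {b} → b ≡ true → T b
T-from-≡ refl = tt

ind-≡ᵇ-subst : ∀ x y (f : ℕ → ℕ) → ind (x ≡ᵇ y) * f x ≡ ind (x ≡ᵇ y) * f y
ind-≡ᵇ-subst x y f with x ≡ᵇ y in e
... | true = cong (λ z → 1 * f z) (≡ᵇ⇒≡ x y (T-from-≡ e))
... | false = refl

T-∧⁻ : ∀ {x y} → T (x ∧ y) → T x × T y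
T-∧⁻ = Equivalence.to T-∧

T-∧⁺ : ∀ {x y} → T x → T y → T (x ∧ y)
T-∧⁺ Tx Ty = Equivalence.from T-∧ (Tx , Ty)

T-does⇒ : ∀ {a} {A : Set a} (a? : Dec A) → T (does a?) → A
T-does⇒ (yes a) _ = a

T-does⇐ : ∀ {a} {A : Set a} (a? : Dec A) → A → T (does a?)
T-does⇐ (yes _) _ = tt
T-does⇐ (no ¬a) a = ¬a a

<ᵇ-suc : ∀ x K → (x <ᵇ suc K) ≡ (x ≤ᵇ K)
<ᵇ-suc zero K = refl
<ᵇ-suc (suc x) K = refl

sumFin : ∀ n → (Fin n → ℕ) → ℕ
sumFin zero f = 0
sumFin (suc n) f = f zero + sumFin n (f ∘ suc)

countFin : ∀ n → (Fin n → Bool) → ℕ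
countFin n P = sumFin n (ind ∘ P)

sumFin-cong : ∀ n {f g : Fin n → ℕ} → (∀ x → f x ≡ g x) → sumFin n f ≡ sumFin n g
sumFin-cong zero e = refl
sumFin-cong (suc n) e = cong₂ _+_ (e zero) (sumFin-cong n (e ∘ suc))

sumFin-mono : ∀ n {f g : Fin n → ℕ} → (∀ x → f x ≤ g x) → sumFin n f ≤ sumFin n g
sumFin-mono zero e = z≤n
sumFin-mono (suc n) e = +-mono-≤ (e zero) (sumFin-mono n (e ∘ suc))

sumFin-+ : ∀ n (f g : Fin n → ℕ) → sumFin n (λ x → f x + g x) ≡ sumFin n f + sumFin n g
sumFin-+ zero f g = refl
sumFin-+ (suc n) f g =
  trans (cong (f zero + g zero +_) (sumFin-+ n _ _)) (+-interchange (f zero) (g zero) _ _)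

sumFin-*ˡ : ∀ n c (f : Fin n → ℕ) → sumFin n (λ x → c * f x) ≡ c * sumFin n f
sumFin-*ˡ zero c f = sym (*-zeroʳ c)
sumFin-*ˡ (suc n) c f = trans (cong (c * f zero +_) (sumFin-*ˡ n c _)) (sym (*-distribˡ-+ c _ _))

sumFin-1 : ∀ n → sumFin n (λ _ → 1) ≡ n
sumFin-1 zero = refl
sumFin-1 (suc n) = cong suc (sumFin-1 n)

count-tabulate : ∀ {a p} {X : Set a} {P : X → Set p} (P? : ∀ x → Dec (P x)) n (f : Fin n → X) →
  count P? (tabulate f) ≡ countFin n (does ∘ P? ∘ f)
count-tabulate P? zero f = refl
count-tabulate P? (suc n) f with does (P? (f zero))
... | true = cong suc (count-tabulate P? n (f ∘ suc))
... | false = count-tabulate P? n (f ∘ suc)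

anyFin : ∀ q → (Fin q → Bool) → Bool
anyFin zero f = false
anyFin (suc q) f = f zero ∨ anyFin q (f ∘ suc)

ind-anyFin≤ : ∀ q (f : Fin q → Bool) → ind (anyFin q f) ≤ countFin q f
ind-anyFin≤ zero f = z≤n
ind-anyFin≤ (suc q) f with f zero
... | true = s≤s z≤n
... | false = ind-anyFin≤ q (f ∘ suc)

T-anyFin : ∀ q (f : Fin q → Bool) i → T (f i) → T (anyFin q f)
T-anyFin (suc q) f zero fi with f zero
... | true = tt
T-anyFin (suc q) f (suc i) fi with f zero
... | true = tt
... | false = T-anyFin q (f ∘ suc) i fi

sumSubsets : ∀ m → (Subset m → ℕ) → ℕ
sumSubsets zero f = f []
sumSubsets (suc m) f = sumSubsets m (f ∘ (false ∷_)) + sumSubsets m (f ∘ (true ∷_))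

sumSubsets-cong : ∀ m {f g : Subset m → ℕ} → (∀ S → f S ≡ g S) → sumSubsets m f ≡ sumSubsets m g
sumSubsets-cong zero e = e []
sumSubsets-cong (suc m) e =
  cong₂ _+_ (sumSubsets-cong m (e ∘ (false ∷_))) (sumSubsets-cong m (e ∘ (true ∷_)))

sumSubsets-mono : ∀ m {f g : Subset m → ℕ} → (∀ S → f S ≤ g S) → sumSubsets m f ≤ sumSubsets m g
sumSubsets-mono zero e = e []
sumSubsets-mono (suc m) e =
  +-mono-≤ (sumSubsets-mono m (e ∘ (false ∷_))) (sumSubsets-mono m (e ∘ (true ∷_)))

sumSubsets-0 : ∀ m {f : Subset m → ℕ} → (∀ S → f S ≡ 0) → sumSubsets m f ≡ 0
sumSubsets-0 zero e = e []
sumSubsets-0 (suc m) e = cong₂ _+_ (sumSubsets-0 m (e ∘ (false ∷_))) (sumSubsets-0 m (e ∘ (true ∷_)))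

sumSubsets-+ : ∀ m (f g : Subset m → ℕ) →
  sumSubsets m (λ S → f S + g S) ≡ sumSubsets m f + sumSubsets m g
sumSubsets-+ zero f g = refl
sumSubsets-+ (suc m) f g =
  trans (cong₂ _+_ (sumSubsets-+ m (f ∘ (false ∷_)) (g ∘ (false ∷_)))
                    (sumSubsets-+ m (f ∘ (true ∷_)) (g ∘ (true ∷_))))
        (+-interchange (sumSubsets m (f ∘ (false ∷_))) _ _ _)

sumSubsets-*ˡ : ∀ m c (f : Subset m → ℕ) → sumSubsets m (λ S → c * f S) ≡ c * sumSubsets m f
sumSubsets-*ˡ zero c f = refl
sumSubsets-*ˡ (suc m) c f =
  trans (cong₂ _+_ (sumSubsets-*ˡ m c _) (sumSubsets-*ˡ m c _)) (sym (*-distribˡ-+ c _ _))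

sumSubsets-sumFin : ∀ m n (g : Subset m → Fin n → ℕ) →
  sumSubsets m (λ S → sumFin n (g S)) ≡ sumFin n (λ j → sumSubsets m (λ S → g S j))
sumSubsets-sumFin m zero g = sumSubsets-0 m (λ _ → refl)
sumSubsets-sumFin m (suc n) g =
  trans (sumSubsets-+ m (λ S → g S zero) (λ S → sumFin n (g S ∘ suc)))
        (cong (sumSubsets m (λ S → g S zero) +_) (sumSubsets-sumFin m n (λ S → g S ∘ suc)))

sumSubsets-<⇒∃ : ∀ m (f g : Subset m → ℕ) → sumSubsets m f < sumSubsets m g → ∃ λ S → f S < g S
sumSubsets-<⇒∃ zero f g lt = [] , lt
sumSubsets-<⇒∃ (suc m) f g lt with sumSubsets m (f ∘ (false ∷_)) <? sumSubsets m (g ∘ (false ∷_))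
... | yes lt₀ = let (S , p) = sumSubsets-<⇒∃ m _ _ lt₀ in false ∷ S , p
... | no ≮₀ = let (S , p) = sumSubsets-<⇒∃ m _ _ (+-cancelˡ-< _ _ _ (≤-<-trans (+-monoˡ-≤ _ (≮⇒≥ ≮₀)) lt))
              in true ∷ S , p

C-pascal : ∀ n k → n C suc k + n C k ≡ suc n C suc k
C-pascal n k = trans (+-comm (n C suc k) (n C k)) (nCk+nC[k+1]≡[n+1]C[k+1] n k)

C-≤-sucˡ : ∀ n k → n C k ≤ suc n C k
C-≤-sucˡ n zero = ≤-refl
C-≤-sucˡ n (suc k) = subst (n C suc k ≤_) (C-pascal n k) (m≤m+n _ _)

C-monoˡ-≤ : ∀ {n n′} k → n ≤ n′ → n C k ≤ n′ C k
C-monoˡ-≤ k n≤n′ = go (≤⇒≤′ n≤n′)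
  where
  go : ∀ {n n′} → n ≤′ n′ → n C k ≤ n′ C k
  go ≤′-refl = ≤-refl
  go (≤′-step {n′} p) = ≤-trans (go p) (C-≤-sucˡ n′ k)

C-absorb : ∀ n k → suc k * (suc n C suc k) ≡ suc n * (n C k)
C-absorb zero zero = refl
C-absorb zero (suc k) = *-zeroʳ (suc (suc k))
C-absorb (suc n) zero = trans (*-identityˡ _) (trans (nC1≡n (suc (suc n))) (sym (*-identityʳ _)))
C-absorb (suc n) (suc k) = begin
  suc (suc k) * (suc (suc n) C suc (suc k))
    ≡⟨ cong (suc (suc k) *_) (sym (C-pascal (suc n) (suc k))) ⟩
  suc (suc k) * (suc n C suc (suc k) + suc n C suc k)
    ≡⟨ split k (suc n C suc (suc k)) (suc n C suc k) ⟩
  suc (suc k) * (suc n C suc (suc k)) + (suc k * (suc n C suc k) + suc n C suc k)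
    ≡⟨ cong₂ (λ x y → x + (y + suc n C suc k)) (C-absorb n (suc k)) (C-absorb n k) ⟩
  suc n * (n C suc k) + (suc n * (n C k) + suc n C suc k)
    ≡⟨ regroup (suc n) (n C suc k) (n C k) (suc n C suc k) ⟩
  suc n * (n C suc k + n C k) + suc n C suc k
    ≡⟨ cong (λ x → suc n * x + suc n C suc k) (C-pascal n k) ⟩
  suc n * (suc n C suc k) + suc n C suc k
    ≡⟨ +-comm (suc n * (suc n C suc k)) _ ⟩
  suc (suc n) * (suc n C suc k) ∎
  where
  open ≡-Reasoning
  split : ∀ k x y → suc (suc k) * (x + y) ≡ suc (suc k) * x + (suc k * y + y)
  split = solve-∀
  regroup : ∀ a x y z → a * x + (a * y + z) ≡ a * (x + y) + z
  regroup = solve-∀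

C-absorb′ : ∀ {m} t → 0 < m → suc t * (m C suc t) ≡ m * ((m ∸ 1) C t)
C-absorb′ {suc m} t _ = C-absorb m t

C-pos : ∀ {l n} → l ≤ n → 0 < n C l
C-pos {zero} _ = ≤-refl
C-pos {suc l} {suc n} (s≤s l≤n) = subst (0 <_) (C-pascal n l) (≤-trans (C-pos l≤n) (m≤n+m _ _))

C≤^ : ∀ l n → n C l ≤ n ^ l
C≤^ zero n = ≤-refl
C≤^ (suc l) zero = z≤n
C≤^ (suc l) (suc n) = begin
  suc n C suc l           ≤⟨ m≤n*m _ (suc l) ⟩
  suc l * (suc n C suc l) ≡⟨ C-absorb n l ⟩
  suc n * (n C l)         ≤⟨ *-monoʳ-≤ (suc n) (≤-trans (C≤^ l n) (^-monoˡ-≤ l (n≤1+n n))) ⟩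
  suc n * suc n ^ l       ∎
  where open ≤-Reasoning

^≤^*C : ∀ a t → suc a ^ t ≤ t ^ t * ((a + t) C t)
^≤^*C a zero = ≤-refl
^≤^*C a (suc t) = begin
  suc a * suc a ^ t                         ≤⟨ *-mono-≤ (s≤s (m≤m+n a t)) (^≤^*C a t) ⟩
  suc (a + t) * (t ^ t * ((a + t) C t))     ≤⟨ *-monoʳ-≤ (suc (a + t)) (*-monoˡ-≤ _ (^-monoˡ-≤ t (n≤1+n t))) ⟩
  suc (a + t) * (suc t ^ t * ((a + t) C t)) ≡⟨ x*[y*z]≡y*[x*z] (suc (a + t)) (suc t ^ t) _ ⟩
  suc t ^ t * (suc (a + t) * ((a + t) C t)) ≡⟨ cong (suc t ^ t *_) (sym (C-absorb (a + t) t)) ⟩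
  suc t ^ t * (suc t * (suc (a + t) C suc t)) ≡⟨ x*[y*z]≡y*[x*z] (suc t ^ t) (suc t) _ ⟩
  suc t * (suc t ^ t * (suc (a + t) C suc t)) ≡⟨ sym (*-assoc (suc t) (suc t ^ t) _) ⟩
  suc t ^ suc t * (suc (a + t) C suc t)     ≡⟨ cong (λ x → suc t ^ suc t * (x C suc t)) (sym (+-suc a t)) ⟩
  suc t ^ suc t * ((a + suc t) C suc t)     ∎
  where
  open ≤-Reasoning
  x*[y*z]≡y*[x*z] : ∀ x y z → x * (y * z) ≡ y * (x * z)
  x*[y*z]≡y*[x*z] = solve-∀

C≤2^*C : ∀ l m b → m + l ≤ 2 * b → m C l ≤ 2 ^ l * (b C l)
C≤2^*C zero m b _ = ≤-refl
C≤2^*C (suc l) zero b _ = z≤n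
C≤2^*C (suc l) (suc m) zero ()
C≤2^*C (suc l) (suc m) (suc b) le = *-cancelˡ-≤ (suc l) (begin
  suc l * (suc m C suc l)               ≡⟨ C-absorb m l ⟩
  suc m * (m C l)                       ≤⟨ *-mono-≤ m+1≤2b+2 (C≤2^*C l m b m+l≤2b) ⟩
  2 * suc b * (2 ^ l * (b C l))         ≡⟨ regroup (suc b) (2 ^ l) (b C l) ⟩
  2 ^ suc l * (suc b * (b C l))         ≡⟨ cong (2 ^ suc l *_) (sym (C-absorb b l)) ⟩
  2 ^ suc l * (suc l * (suc b C suc l)) ≡⟨ x*[y*z]≡y*[x*z] (2 ^ suc l) (suc l) _ ⟩
  suc l * (2 ^ suc l * (suc b C suc l)) ∎)
  where
  open ≤-Reasoning
  regroup : ∀ x y z → 2 * x * (y * z) ≡ 2 * y * (x * z)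
  regroup = solve-∀
  x*[y*z]≡y*[x*z] : ∀ x y z → x * (y * z) ≡ y * (x * z)
  x*[y*z]≡y*[x*z] = solve-∀
  2+[m+l]≤2+2b : 2 + (m + l) ≤ 2 + 2 * b
  2+[m+l]≤2+2b = ≤-trans (≤-reflexive (cong suc (sym (+-suc m l)))) (≤-trans le (≤-reflexive (*-suc 2 b)))
  m+l≤2b : m + l ≤ 2 * b
  m+l≤2b = ≤-pred (≤-pred 2+[m+l]≤2+2b)
  m+1≤2b+2 : suc m ≤ 2 * suc b
  m+1≤2b+2 = ≤-trans (m≤m+n (suc m) (suc l)) le

[1+t]Ct≡1+t : ∀ t → suc t C t ≡ suc t
[1+t]Ct≡1+t t = trans (nCk≡nC[n∸k] (n≤1+n t)) (trans (cong (suc t C_) (m+n∸n≡m 1 t)) (nC1≡n (suc t)))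

3+t≤[3+t]C[1+t] : ∀ t → 3 + t ≤ (3 + t) C (1 + t)
3+t≤[3+t]C[1+t] t = begin
  3 + t                          ≡⟨ +-comm 1 (2 + t) ⟩
  (2 + t) + 1                    ≤⟨ +-monoʳ-≤ (2 + t) (C-pos (≤-trans (n≤1+n t) (n≤1+n (suc t)))) ⟩
  (2 + t) + (2 + t) C t          ≡⟨ cong (_+ (2 + t) C t) (sym ([1+t]Ct≡1+t (suc t))) ⟩
  (2 + t) C (1 + t) + (2 + t) C t ≡⟨ C-pascal (2 + t) t ⟩
  (3 + t) C (1 + t)              ∎
  where open ≤-Reasoning

[m*n]^k≡m^k*n^k : ∀ m n k → (m * n) ^ k ≡ m ^ k * n ^ k
[m*n]^k≡m^k*n^k m n zero = refl
[m*n]^k≡m^k*n^k m n (suc k) = trans (cong (m * n *_) ([m*n]^k≡m^k*n^k m n k)) (interchange m n (m ^ k) (n ^ k))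
  where
  interchange : ∀ a b c d → a * b * (c * d) ≡ a * c * (b * d)
  interchange = solve-∀

_⊆ᵇ_ : ∀ {m} → Subset m → Subset m → Bool
S ⊆ᵇ B = does (S ⊆? B)

_∈ᵇ_ : ∀ {m} → Fin m → Subset m → Bool
r ∈ᵇ S = does (r ∈? S)

∈⇒suc[∣p∣∸1]≡∣p∣ : ∀ {m} {r : Fin m} {B : Subset m} → r ∈ B → suc (∣ B ∣ ∸ 1) ≡ ∣ B ∣
∈⇒suc[∣p∣∸1]≡∣p∣ here = refl
∈⇒suc[∣p∣∸1]≡∣p∣ {B = true ∷ B} (there r∈B) = refl
∈⇒suc[∣p∣∸1]≡∣p∣ {B = false ∷ B} (there r∈B) = ∈⇒suc[∣p∣∸1]≡∣p∣ r∈B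

∣p∣≡countFin∈ᵇ : ∀ {m} (S : Subset m) → ∣ S ∣ ≡ countFin m (_∈ᵇ S)
∣p∣≡countFin∈ᵇ [] = refl
∣p∣≡countFin∈ᵇ (true ∷ S) = cong suc (∣p∣≡countFin∈ᵇ S)
∣p∣≡countFin∈ᵇ (false ∷ S) = ∣p∣≡countFin∈ᵇ S

Injection-into : ∀ {q n} → (Fin n → Bool) → Set
Injection-into {q} {n} P = Σ (Fin q → Fin n) λ c → (∀ i → T (P (c i))) × Injective _≡_ _≡_ c

≤countFin⇒injection : ∀ n (P : Fin n → Bool) q → q ≤ countFin n P → Injection-into {q} P
≤countFin⇒injection zero P zero _ = (λ ()) , (λ ()) , λ {}
≤countFin⇒injection (suc n) P q le with P zero in P0 | ≤countFin⇒injection n (P ∘ suc)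
... | false | rec = let c , Pc , c-inj = rec q le in suc ∘ c , Pc , c-inj ∘ Fin-suc-injective
... | true | rec with q | le
...   | zero | _ = (λ ()) , (λ ()) , λ {}
...   | suc q | s≤s le′ = let c , Pc , c-inj = rec q le′ in extend c , extend-P Pc , extend-inj c-inj
  where
  extend : (Fin q → Fin n) → Fin (suc q) → Fin (suc n)
  extend c zero = zero
  extend c (suc i) = suc (c i)
  extend-P : ∀ {c} → (∀ i → T (P (suc (c i)))) → ∀ i → T (P (extend c i))
  extend-P Pc zero = T-from-≡ P0
  extend-P Pc (suc i) = Pc i
  extend-inj : ∀ {c} → Injective _≡_ _≡_ c → Injective _≡_ _≡_ (extend c)
  extend-inj c-inj {zero} {zero} _ = refl
  extend-inj c-inj {suc i} {suc i′} e = cong suc (c-inj (Fin-suc-injective e))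

¬injection⇒countFin≤ : ∀ n (P : Fin n → Bool) q → ¬ Injection-into {suc q} P → countFin n P ≤ q
¬injection⇒countFin≤ n P q ¬inj with countFin n P ≤? q
... | yes le = le
... | no ≰ = contradiction (≤countFin⇒injection n P (suc q) (≰⇒> ≰)) ¬inj

enumerate : ∀ {m} (S : Subset m) → Σ (Fin ∣ S ∣ → Fin m) λ e → (∀ i → e i ∈ S) × Injective _≡_ _≡_ e
enumerate {m} S with ≤countFin⇒injection m (_∈ᵇ S) ∣ S ∣ (≤-reflexive (∣p∣≡countFin∈ᵇ S))
... | e , e∈S , e-inj = e , (λ i → T-does⇒ (e i ∈? S) (e∈S i)) , e-inj

⊆-of-size : ∀ {m} (p : Subset m) l → l ≤ ∣ p ∣ → Σ (Subset m) λ L → ∣ L ∣ ≡ l × L ⊆ p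
⊆-of-size {m} p zero _ = ∅ , ∣⊥∣≡0 m , ⊥⊆
⊆-of-size (false ∷ p) (suc l) le with ⊆-of-size p (suc l) le
... | L , ∣L∣≡l , L⊆p = false ∷ L , ∣L∣≡l , λ { (there x∈L) → there (L⊆p x∈L) }
⊆-of-size (true ∷ p) (suc l) (s≤s le) with ⊆-of-size p l le
... | L , ∣L∣≡l , L⊆p = true ∷ L , cong suc ∣L∣≡l , λ { here → here ; (there x∈L) → there (L⊆p x∈L) }

⊆∧∣≡∣⇒≡ : ∀ {m} {S B : Subset m} → S ⊆ B → ∣ S ∣ ≡ ∣ B ∣ → S ≡ B
⊆∧∣≡∣⇒≡ {S = []} {[]} _ _ = refl
⊆∧∣≡∣⇒≡ {S = true ∷ S} {true ∷ B} S⊆B e =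
  cong (true ∷_) (⊆∧∣≡∣⇒≡ (drop-∷-⊆ S⊆B) (suc-injective e))
⊆∧∣≡∣⇒≡ {S = true ∷ S} {false ∷ B} S⊆B e with S⊆B here
... | ()
⊆∧∣≡∣⇒≡ {S = false ∷ S} {false ∷ B} S⊆B e = cong (false ∷_) (⊆∧∣≡∣⇒≡ (drop-∷-⊆ S⊆B) e)
⊆∧∣≡∣⇒≡ {S = false ∷ S} {true ∷ B} S⊆B e =
  contradiction (p⊆q⇒∣p∣≤∣q∣ (drop-∷-⊆ S⊆B)) (<⇒≱ (≤-reflexive (sym e)))

∣p∪q∣≤∣p∣+∣q∣ : ∀ {m} (p q : Subset m) → ∣ p ∪ q ∣ ≤ ∣ p ∣ + ∣ q ∣
∣p∪q∣≤∣p∣+∣q∣ [] [] = z≤n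
∣p∪q∣≤∣p∣+∣q∣ (false ∷ p) (false ∷ q) = ∣p∪q∣≤∣p∣+∣q∣ p q
∣p∪q∣≤∣p∣+∣q∣ (false ∷ p) (true ∷ q) =
  ≤-trans (s≤s (∣p∪q∣≤∣p∣+∣q∣ p q)) (≤-reflexive (sym (+-suc ∣ p ∣ ∣ q ∣)))
∣p∪q∣≤∣p∣+∣q∣ (true ∷ p) (b ∷ q) =
  s≤s (≤-trans (∣p∪q∣≤∣p∣+∣q∣ p q) (+-monoʳ-≤ ∣ p ∣ (∣p∣≤∣x∷p∣ b q)))

⋃ᶠ : ∀ {m} q → (Fin q → Subset m) → Subset m
⋃ᶠ zero f = ∅
⋃ᶠ (suc q) f = f zero ∪ ⋃ᶠ q (f ∘ suc)

∣⋃ᶠ∣≤ : ∀ {m} q K (f : Fin q → Subset m) → (∀ i → ∣ f i ∣ ≤ K) → ∣ ⋃ᶠ q f ∣ ≤ q * K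
∣⋃ᶠ∣≤ {m} zero K f _ = ≤-reflexive (∣⊥∣≡0 m)
∣⋃ᶠ∣≤ (suc q) K f le =
  ≤-trans (∣p∪q∣≤∣p∣+∣q∣ (f zero) _) (+-mono-≤ (le zero) (∣⋃ᶠ∣≤ q K (f ∘ suc) (le ∘ suc)))

⊆⋃ᶠ : ∀ {m} q (f : Fin q → Subset m) i → f i ⊆ ⋃ᶠ q f
⊆⋃ᶠ (suc q) f zero = p⊆p∪q _
⊆⋃ᶠ (suc q) f (suc i) = q⊆p∪q (f zero) _ ∘ ⊆⋃ᶠ q (f ∘ suc) i

ind-⊆ᵇ⊤ : ∀ {m} (S : Subset m) → ind (S ⊆ᵇ ⊤) ≡ 1
ind-⊆ᵇ⊤ S = cong ind (dec-true (S ⊆? ⊤) ⊆⊤)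

sumOfSize : ∀ m → ℕ → (Subset m → ℕ) → ℕ
sumOfSize m t f = sumSubsets m (λ S → ind (∣ S ∣ ≡ᵇ t) * f S)

size-indicator-elim : ∀ {m} (S : Subset m) t (P : ℕ → Set) →
  (∣ S ∣ ≡ t → P 1) → P 0 → P (ind (∣ S ∣ ≡ᵇ t))
size-indicator-elim S t P p₁ p₀ with ∣ S ∣ ≡ᵇ t in eq
... | true = p₁ (≡ᵇ⇒≡ ∣ S ∣ t (T-from-≡ eq))
... | false = p₀

module _ {m : ℕ} {t : ℕ} where

  sumOfSize-cong : {f g : Subset m → ℕ} → (∀ S → ∣ S ∣ ≡ t → f S ≡ g S) →
    sumOfSize m t f ≡ sumOfSize m t g
  sumOfSize-cong {f} {g} e = sumSubsets-cong m λ S →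
    size-indicator-elim S t (λ w → w * f S ≡ w * g S) (cong (1 *_) ∘ e S) refl

  sumOfSize-≤ : {f g : Subset m → ℕ} → (∀ S → ∣ S ∣ ≡ t → f S ≤ g S) →
    sumOfSize m t f ≤ sumOfSize m t g
  sumOfSize-≤ {f} {g} le = sumSubsets-mono m λ S →
    size-indicator-elim S t (λ w → w * f S ≤ w * g S) (*-monoʳ-≤ 1 ∘ le S) z≤n

  sumOfSize-+ : ∀ (f g : Subset m → ℕ) →
    sumOfSize m t (λ S → f S + g S) ≡ sumOfSize m t f + sumOfSize m t g
  sumOfSize-+ f g = trans (sumSubsets-cong m (λ S → *-distribˡ-+ (ind (∣ S ∣ ≡ᵇ t)) (f S) (g S)))
                          (sumSubsets-+ m _ _)

  sumOfSize-*ˡ : ∀ c (f : Subset m → ℕ) → sumOfSize m t (λ S → c * f S) ≡ c * sumOfSize m t f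
  sumOfSize-*ˡ c f = trans (sumSubsets-cong m (λ S → x*[y*z]≡y*[x*z] (ind (∣ S ∣ ≡ᵇ t)) c (f S)))
                           (sumSubsets-*ˡ m c _)
    where
    x*[y*z]≡y*[x*z] : ∀ x y z → x * (y * z) ≡ y * (x * z)
    x*[y*z]≡y*[x*z] = solve-∀

  sumOfSize-sumFin : ∀ n (g : Subset m → Fin n → ℕ) →
    sumOfSize m t (λ S → sumFin n (g S)) ≡ sumFin n (λ j → sumOfSize m t (λ S → g S j))
  sumOfSize-sumFin n g =
    trans (sumSubsets-cong m (λ S → sym (sumFin-*ˡ n (ind (∣ S ∣ ≡ᵇ t)) (g S)))) (sumSubsets-sumFin m n _)

  sumOfSize-<⇒∃ : ∀ (f g : Subset m → ℕ) → sumOfSize m t f < sumOfSize m t g →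
    ∃ λ S → ∣ S ∣ ≡ t × f S < g S
  sumOfSize-<⇒∃ f g lt with sumSubsets-<⇒∃ m _ _ lt
  ... | S , wfS<wgS = size-indicator-elim S t (λ w → w * f S < w * g S → ∃ λ S → ∣ S ∣ ≡ t × f S < g S)
        (λ ∣S∣≡t fS<gS → S , ∣S∣≡t , subst₂ _<_ (+-identityʳ (f S)) (+-identityʳ (g S)) fS<gS)
        (λ 0<0 → contradiction 0<0 (n≮n 0)) wfS<wgS

sumOfSize-⊆ᵇ : ∀ {m} (B : Subset m) t → sumOfSize m t (λ S → ind (S ⊆ᵇ B)) ≡ ∣ B ∣ C t
sumOfSize-⊆ᵇ [] zero = refl
sumOfSize-⊆ᵇ [] (suc t) = refl
sumOfSize-⊆ᵇ {suc m} (false ∷ B) t =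
  trans (cong₂ _+_ (sumOfSize-⊆ᵇ B t) (sumSubsets-0 m (λ S → *-zeroʳ (ind (∣ true ∷ S ∣ ≡ᵇ t)))))
        (+-identityʳ _)
sumOfSize-⊆ᵇ {suc m} (true ∷ B) zero =
  trans (cong₂ _+_ (sumOfSize-⊆ᵇ B zero) (sumSubsets-0 m (λ _ → refl))) refl
sumOfSize-⊆ᵇ (true ∷ B) (suc t) =
  trans (cong₂ _+_ (sumOfSize-⊆ᵇ B (suc t)) (sumOfSize-⊆ᵇ B t)) (C-pascal ∣ B ∣ t)

sumOfSize-1 : ∀ m t → sumOfSize m t (λ _ → 1) ≡ m C t
sumOfSize-1 m t = begin
  sumOfSize m t (λ _ → 1)           ≡⟨ sumOfSize-cong {m} {t} (λ S _ → sym (ind-⊆ᵇ⊤ S)) ⟩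
  sumOfSize m t (λ S → ind (S ⊆ᵇ ⊤)) ≡⟨ sumOfSize-⊆ᵇ (⊤ {m}) t ⟩
  ∣ ⊤ {m} ∣ C t                      ≡⟨ cong (_C t) (∣⊤∣≡n m) ⟩
  m C t                             ∎
  where open ≡-Reasoning

sumOfSize-bound : ∀ {m t} (f : Subset m → ℕ) b → (∀ S → ∣ S ∣ ≡ t → f S ≤ b) →
  sumOfSize m t f ≤ b * (m C t)
sumOfSize-bound {m} {t} f b le = begin
  sumOfSize m t f             ≤⟨ sumOfSize-≤ {g = λ _ → b * 1} (λ S → subst (_ ≤_) (sym (*-identityʳ b)) ∘ le S) ⟩
  sumOfSize m t (λ _ → b * 1) ≡⟨ sumOfSize-*ˡ {m} {t} b (λ _ → 1) ⟩
  b * sumOfSize m t (λ _ → 1) ≡⟨ cong (b *_) (sumOfSize-1 m t) ⟩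
  b * (m C t)                 ∎
  where open ≤-Reasoning

sumOfSize-* : ∀ {m t ℓ} (f g : Subset m → ℕ) →
  sumOfSize m t (λ S → sumOfSize m ℓ (λ L → f S * g L)) ≡ sumOfSize m t f * sumOfSize m ℓ g
sumOfSize-* {m} {t} {ℓ} f g = begin
  sumOfSize m t (λ S → sumOfSize m ℓ (λ L → f S * g L)) ≡⟨ sumOfSize-cong {m} {t} (λ S _ → sumOfSize-*ˡ (f S) g) ⟩
  sumOfSize m t (λ S → f S * sumOfSize m ℓ g)           ≡⟨ sumOfSize-cong {m} {t} (λ S _ → *-comm (f S) _) ⟩
  sumOfSize m t (λ S → sumOfSize m ℓ g * f S)           ≡⟨ sumOfSize-*ˡ (sumOfSize m ℓ g) f ⟩
  sumOfSize m ℓ g * sumOfSize m t f                     ≡⟨ *-comm (sumOfSize m ℓ g) _ ⟩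
  sumOfSize m t f * sumOfSize m ℓ g                     ∎
  where open ≡-Reasoning

empty-∌ : ∀ {m} (S : Subset m) r x → ind (∣ S ∣ ≡ᵇ 0) * (ind (r ∈ᵇ S) * x) ≡ 0
empty-∌ (false ∷ S) zero x = *-zeroʳ (ind (∣ S ∣ ≡ᵇ 0))
empty-∌ (false ∷ S) (suc r) x = empty-∌ S r x
empty-∌ (true ∷ S) r x = refl

sumOfSize-∈ᵇ-⊆ᵇ : ∀ {m} {r : Fin m} {B : Subset m} → r ∈ B → ∀ t →
  sumOfSize m (suc t) (λ S → ind (r ∈ᵇ S) * ind (S ⊆ᵇ B)) ≡ (∣ B ∣ ∸ 1) C t
sumOfSize-∈ᵇ-⊆ᵇ {suc m} {B = true ∷ B} here t =
  trans (cong₂ _+_ (sumSubsets-0 m (λ S → *-zeroʳ (ind (∣ S ∣ ≡ᵇ suc t))))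
                   (sumSubsets-cong m (λ S → cong (ind (∣ S ∣ ≡ᵇ t) *_) (+-identityʳ (ind (S ⊆ᵇ B))))))
        (sumOfSize-⊆ᵇ B t)
sumOfSize-∈ᵇ-⊆ᵇ {suc m} {suc r} {false ∷ B} (there r∈B) t =
  trans (cong₂ _+_ (sumOfSize-∈ᵇ-⊆ᵇ r∈B t)
                   (sumSubsets-0 m (λ S → trans (cong (ind (∣ S ∣ ≡ᵇ t) *_) (*-zeroʳ (ind (r ∈ᵇ S))))
                                                (*-zeroʳ (ind (∣ S ∣ ≡ᵇ t))))))
        (+-identityʳ _)
sumOfSize-∈ᵇ-⊆ᵇ {suc m} {suc r} {true ∷ B} (there r∈B) zero =
  trans (cong₂ _+_ (sumOfSize-∈ᵇ-⊆ᵇ r∈B zero) (sumSubsets-0 m (λ S → empty-∌ S r _))) (+-identityʳ _)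
sumOfSize-∈ᵇ-⊆ᵇ {suc m} {B = true ∷ B} (there r∈B) (suc t) =
  trans (cong₂ _+_ (sumOfSize-∈ᵇ-⊆ᵇ r∈B (suc t)) (sumOfSize-∈ᵇ-⊆ᵇ r∈B t))
        (trans (C-pascal (∣ B ∣ ∸ 1) t) (cong (_C suc t) (∈⇒suc[∣p∣∸1]≡∣p∣ r∈B)))

sumOfSize-∈ᵇ : ∀ m (r : Fin m) t → sumOfSize m (suc t) (λ S → ind (r ∈ᵇ S)) ≡ (m ∸ 1) C t
sumOfSize-∈ᵇ m r t = begin
  sumOfSize m (suc t) (λ S → ind (r ∈ᵇ S))
    ≡⟨ sumOfSize-cong {m} {suc t} (λ S _ → trans (sym (*-identityʳ _)) (cong (ind (r ∈ᵇ S) *_) (sym (ind-⊆ᵇ⊤ S)))) ⟩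
  sumOfSize m (suc t) (λ S → ind (r ∈ᵇ S) * ind (S ⊆ᵇ ⊤))
    ≡⟨ sumOfSize-∈ᵇ-⊆ᵇ (∈⊤ {x = r}) t ⟩
  (∣ ⊤ {m} ∣ ∸ 1) C t
    ≡⟨ cong (λ x → (x ∸ 1) C t) (∣⊤∣≡n m) ⟩
  (m ∸ 1) C t ∎
  where open ≡-Reasoning

module _ {m n} (A : Matrix m n) where

  ∈I⇒true : ∀ {x j} → x ∈ I A j → A x j ≡ true
  ∈I⇒true {x} {j} x∈I = trans (sym (lookup∘tabulate (λ i → A i j) x)) ([]=⇒lookup x∈I)

  true⇒∈I : ∀ {x j} → A x j ≡ true → x ∈ I A j
  true⇒∈I {x} {j} e = lookup⇒[]= x (I A j) (trans (lookup∘tabulate (λ i → A i j) x) e)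

  ∈∁I⇒false : ∀ {x j} → x ∈ ∁ (I A j) → A x j ≡ false
  ∈∁I⇒false {x} {j} x∈∁I with A x j in e
  ... | true = contradiction (true⇒∈I e) (x∈∁p⇒x∉p x∈∁I)
  ... | false = refl

splitAt-injective : ∀ t {ℓ} → Injective _≡_ _≡_ (splitAt t {ℓ})
splitAt-injective t {ℓ} {i} {i′} e =
  trans (sym (join-splitAt t ℓ i)) (trans (cong (join t ℓ) e) (join-splitAt t ℓ i′))

[,]-injective : ∀ {a b c} {X : Set a} {Y : Set b} {Z : Set c} {f : X → Z} {g : Y → Z} →
  Injective _≡_ _≡_ f → Injective _≡_ _≡_ g → (∀ x y → f x ≢ g y) → Injective _≡_ _≡_ [ f , g ]′
[,]-injective f-inj g-inj f≢g {inj₁ x} {inj₁ x′} e = cong inj₁ (f-inj e)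
[,]-injective f-inj g-inj f≢g {inj₁ x} {inj₂ y′} e = contradiction e (f≢g x y′)
[,]-injective f-inj g-inj f≢g {inj₂ y} {inj₁ x′} e = contradiction (sym e) (f≢g x′ y)
[,]-injective f-inj g-inj f≢g {inj₂ y} {inj₂ y′} e = cong inj₂ (g-inj e)

toℕ<ᵇ-splitAt : ∀ t {ℓ} (i : Fin (t + ℓ)) → (toℕ i <ᵇ t) ≡ [ (λ _ → true) , (λ _ → false) ]′ (splitAt t i)
toℕ<ᵇ-splitAt zero i = refl
toℕ<ᵇ-splitAt (suc t) zero = refl
toℕ<ᵇ-splitAt (suc t) (suc i) with splitAt t i in e
... | inj₁ _ = trans (toℕ<ᵇ-splitAt t i) (cong [ _ , _ ]′ e)
... | inj₂ _ = trans (toℕ<ᵇ-splitAt t i) (cong [ _ , _ ]′ e)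

-- Rows: S followed by L. Since q ≠ 0, some column c i₀ contains S and avoids L, so S and L are disjoint.
≺-copies1t0l : ∀ {m n q} (A : Matrix m n) .{{_ : NonZero q}} {S L : Subset m} →
  (c : Fin q → Fin n) → Injective _≡_ _≡_ c →
  (∀ i → S ⊆ I A (c i)) → (∀ i → L ⊆ ∁ (I A (c i))) → copies1t0l q ∣ S ∣ ∣ L ∣ ≺ A
≺-copies1t0l {m} {q = q} A {S} {L} c c-inj S⊆ L⊆∁ =
  rows , c , (λ e → splitAt-injective ∣ S ∣ ([,]-injective eS-inj eL-inj disjoint e)) , c-inj , entry
  where
  i₀ : Fin q
  i₀ = fromℕ< (>-nonZero⁻¹ q)
  eS = proj₁ (enumerate S)
  eL = proj₁ (enumerate L)
  eS-inj = proj₂ (proj₂ (enumerate S))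
  eL-inj = proj₂ (proj₂ (enumerate L))
  rows : Fin (∣ S ∣ + ∣ L ∣) → Fin m
  rows = [ eS , eL ]′ ∘ splitAt ∣ S ∣
  inS : ∀ a j → A (eS a) (c j) ≡ true
  inS a j = ∈I⇒true A (S⊆ j (proj₁ (proj₂ (enumerate S)) a))
  inL : ∀ b j → A (eL b) (c j) ≡ false
  inL b j = ∈∁I⇒false A (L⊆∁ j (proj₁ (proj₂ (enumerate L)) b))
  disjoint : ∀ a b → eS a ≢ eL b
  disjoint a b e with trans (sym (inS a i₀)) (trans (cong (λ x → A x (c i₀)) e) (inL b i₀))
  ... | ()
  entry : ∀ i j → A (rows i) (c j) ≡ copies1t0l q ∣ S ∣ ∣ L ∣ i j
  entry i j with splitAt ∣ S ∣ i in e
  ... | inj₁ a = trans (inS a j) (sym (trans (toℕ<ᵇ-splitAt ∣ S ∣ i) (cong [ _ , _ ]′ e)))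
  ... | inj₂ b = trans (inL b j) (sym (trans (toℕ<ᵇ-splitAt ∣ S ∣ i) (cong [ _ , _ ]′ e)))

module ForbiddenConfiguration (t ℓ lam : ℕ) {m n : ℕ} (A : Matrix m n)
  (no-config : ¬ (copies1t0l (lam + 2) t ℓ ≺ A)) where

  ¬≺ : ∀ (c : Fin (2 + lam) → Fin n) → Injective _≡_ _≡_ c → ∀ {S L} → ∣ S ∣ ≡ t → ∣ L ∣ ≡ ℓ →
    (∀ i → S ⊆ I A (c i)) → (∀ i → L ⊆ ∁ (I A (c i))) → ⊥
  ¬≺ c c-inj ∣S∣≡t ∣L∣≡ℓ S⊆ L⊆∁ =
    subst (λ q → ¬ copies1t0l q t ℓ ≺ A) (+-comm lam 2) no-config
      (subst₂ (λ a b → copies1t0l (2 + lam) a b ≺ A) ∣S∣≡t ∣L∣≡ℓ (≺-copies1t0l A c c-inj S⊆ L⊆∁))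

  columns-⊇-⊆∁ : ∀ (Q : Fin n → Bool) {S L} → ∣ S ∣ ≡ t → ∣ L ∣ ≡ ℓ →
    countFin n (λ j → Q j ∧ (S ⊆ᵇ I A j ∧ L ⊆ᵇ ∁ (I A j))) ≤ suc lam
  columns-⊇-⊆∁ Q {S} {L} ∣S∣≡t ∣L∣≡ℓ = ¬injection⇒countFin≤ n _ (suc lam) λ (c , Pc , c-inj) →
    ¬≺ c c-inj ∣S∣≡t ∣L∣≡ℓ
       (λ i → T-does⇒ (S ⊆? _) (proj₁ (T-∧⁻ (proj₂ (T-∧⁻ {Q (c i)} (Pc i))))))
       (λ i → T-does⇒ (L ⊆? _) (proj₂ (T-∧⁻ (proj₂ (T-∧⁻ {Q (c i)} (Pc i))))))

  light-columns-⊇ : ∀ K {S} → ∣ S ∣ ≡ t → (2 + lam) * K + ℓ ≤ m →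
    countFin n (λ j → (colSum A j ≤ᵇ K) ∧ S ⊆ᵇ I A j) ≤ suc lam
  light-columns-⊇ K {S} ∣S∣≡t room = ¬injection⇒countFin≤ n _ (suc lam) λ (c , Pc , c-inj) →
    let U = ⋃ᶠ (2 + lam) (I A ∘ c)
        ∣U∣≤ : ∣ U ∣ ≤ (2 + lam) * K
        ∣U∣≤ = ∣⋃ᶠ∣≤ (2 + lam) K (I A ∘ c) λ i → ≤ᵇ⇒≤ _ K (proj₁ (T-∧⁻ (Pc i)))
        ℓ≤∣∁U∣ : ℓ ≤ ∣ ∁ U ∣
        ℓ≤∣∁U∣ = subst (ℓ ≤_) (sym (∣∁p∣≡n∸∣p∣ U))
                   (m+n≤o⇒m≤o∸n ℓ (≤-trans (≤-reflexive (+-comm ℓ _)) (≤-trans (+-monoˡ-≤ ℓ ∣U∣≤) room)))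
        (L , ∣L∣≡ℓ , L⊆∁U) = ⊆-of-size (∁ U) ℓ ℓ≤∣∁U∣
    in ¬≺ c c-inj ∣S∣≡t ∣L∣≡ℓ
          (λ i → T-does⇒ (S ⊆? _) (proj₂ (T-∧⁻ {colSum A (c i) ≤ᵇ K} (Pc i))))
          (λ i → p⊆q⇒∁p⊇∁q (⊆⋃ᶠ (2 + lam) (I A ∘ c) i) ∘ L⊆∁U)

C-large-complement : ∀ {c₀ ℓ m b x} → m + ℓ ≤ 2 * b → 2 ^ ℓ * c₀ ≤ x → c₀ * (m C ℓ) ≤ x * (b C ℓ)
C-large-complement {c₀} {ℓ} {m} {b} {x} m+ℓ≤2b 2^ℓc₀≤x = begin
  c₀ * (m C ℓ)          ≤⟨ *-monoʳ-≤ c₀ (C≤2^*C ℓ m b m+ℓ≤2b) ⟩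
  c₀ * (2 ^ ℓ * (b C ℓ)) ≡⟨ sym (*-assoc c₀ (2 ^ ℓ) _) ⟩
  c₀ * 2 ^ ℓ * (b C ℓ)   ≡⟨ cong (_* (b C ℓ)) (*-comm c₀ (2 ^ ℓ)) ⟩
  2 ^ ℓ * c₀ * (b C ℓ)   ≤⟨ *-monoˡ-≤ (b C ℓ) 2^ℓc₀≤x ⟩
  x * (b C ℓ)            ∎
  where open ≤-Reasoning

-- Compare both sides with m^t: m ≤ 4x gives m^t ≤ (4t)^t t^t C(x,t), and ℓ < t gives C(m,ℓ)·m ≤ m^t.
C-large-column : ∀ {t ℓ c₀ m x} → ℓ < t → t ≤ x → m ≤ 4 * x → 0 < c₀ →
  (4 * t) ^ t * t ^ t * c₀ ≤ m → c₀ * (m C ℓ) ≤ x C t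
C-large-column {t} {ℓ} {c₀} {m} {x} ℓ<t t≤x m≤4x 0<c₀ Pc₀≤m =
  *-cancelˡ-≤ P {{>-nonZero 0<P}} (≤-trans upper lower)
  where
  instance _ = >-nonZero (≤-trans (s≤s z≤n) ℓ<t)
  a = x ∸ t
  a+t≡x : a + t ≡ x
  a+t≡x = m∸n+n≡m t≤x
  P = (4 * t) ^ t * t ^ t
  0<P : 0 < P
  0<P = *-mono-< {0} {_} {0} (m^n>0 (4 * t) {{m*n≢0 4 t}} t) (m^n>0 t t)
  x≤t*[1+a] : x ≤ t * suc a
  x≤t*[1+a] = begin
    x           ≡⟨ sym a+t≡x ⟩
    a + t       ≡⟨ +-comm a t ⟩
    t + a       ≤⟨ +-monoʳ-≤ t (m≤n*m a t) ⟩
    t + t * a   ≡⟨ sym (*-suc t a) ⟩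
    t * suc a   ∎
    where open ≤-Reasoning
  lower : m ^ t ≤ P * (x C t)
  lower = begin
    m ^ t                                  ≤⟨ ^-monoˡ-≤ t (≤-trans m≤4x (*-monoʳ-≤ 4 x≤t*[1+a])) ⟩
    (4 * (t * suc a)) ^ t                  ≡⟨ cong (_^ t) (sym (*-assoc 4 t (suc a))) ⟩
    (4 * t * suc a) ^ t                    ≡⟨ [m*n]^k≡m^k*n^k (4 * t) (suc a) t ⟩
    (4 * t) ^ t * suc a ^ t                ≤⟨ *-monoʳ-≤ ((4 * t) ^ t) (^≤^*C a t) ⟩
    (4 * t) ^ t * (t ^ t * ((a + t) C t))  ≡⟨ sym (*-assoc ((4 * t) ^ t) (t ^ t) _) ⟩
    P * ((a + t) C t)                      ≡⟨ cong (λ y → P * (y C t)) a+t≡x ⟩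
    P * (x C t)                            ∎
    where open ≤-Reasoning
  0<m : 0 < m
  0<m = ≤-trans (*-mono-≤ 0<P 0<c₀) Pc₀≤m
  upper : P * (c₀ * (m C ℓ)) ≤ m ^ t
  upper = begin
    P * (c₀ * (m C ℓ)) ≡⟨ sym (*-assoc P c₀ _) ⟩
    P * c₀ * (m C ℓ)   ≤⟨ *-mono-≤ Pc₀≤m (C≤^ ℓ m) ⟩
    m ^ suc ℓ          ≤⟨ ^-monoʳ-≤ m {{>-nonZero 0<m}} ℓ<t ⟩
    m ^ t              ∎
    where open ≤-Reasoning

≮half⇒≤4* : ∀ {m ℓ x} → x ≤ m → 2 * ℓ ≤ m → 2 * (m ∸ x) < m + ℓ → m ≤ 4 * x
≮half⇒≤4* {m} {ℓ} {x} x≤m 2ℓ≤m lt = +-cancelʳ-≤ m m (4 * x) (begin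
  m + m            ≡⟨ cong (λ z → z + z) (sym y+x≡m) ⟩
  (y + x) + (y + x) ≤⟨ +-mono-≤ (+-monoˡ-≤ x y≤x+ℓ) (+-monoˡ-≤ x y≤x+ℓ) ⟩
  (x + ℓ + x) + (x + ℓ + x) ≡⟨ regroup x ℓ ⟩
  4 * x + 2 * ℓ    ≤⟨ +-monoʳ-≤ (4 * x) 2ℓ≤m ⟩
  4 * x + m        ∎)
  where
  open ≤-Reasoning
  y = m ∸ x
  y+x≡m : y + x ≡ m
  y+x≡m = m∸n+n≡m x≤m
  y≤x+ℓ : y ≤ x + ℓ
  y≤x+ℓ = <⇒≤ (+-cancelˡ-< y y (x + ℓ) (begin-strict
    y + y          ≡⟨ cong (y +_) (sym (+-identityʳ y)) ⟩
    2 * y          <⟨ lt ⟩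
    m + ℓ          ≡⟨ cong (_+ ℓ) (sym y+x≡m) ⟩
    y + x + ℓ      ≡⟨ +-assoc y x ℓ ⟩
    y + (x + ℓ)    ∎))
  regroup : ∀ x ℓ → (x + ℓ + x) + (x + ℓ + x) ≡ 4 * x + 2 * ℓ
  regroup = solve-∀

-- Either the complement of the column has at least (m+ℓ)/2 rows, or the column has at least m/4.
heavy-column-weight : ∀ {t ℓ c₀ K m x} → ℓ < t → t ≤ K → 0 < c₀ → 2 ^ ℓ * c₀ ≤ suc K C t →
  (4 * t) ^ t * t ^ t * c₀ + 2 * ℓ ≤ m → K < x → x + ℓ ≤ m → c₀ * (m C ℓ) ≤ (x C t) * ((m ∸ x) C ℓ)
heavy-column-weight {t} {ℓ} {c₀} {K} {m} {x} ℓ<t t≤K 0<c₀ 2^ℓc₀≤C big K<x x+ℓ≤m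
  with m + ℓ ≤? 2 * (m ∸ x)
... | yes m+ℓ≤2[m∸x] = C-large-complement {c₀} {ℓ} {m} m+ℓ≤2[m∸x] (≤-trans 2^ℓc₀≤C (C-monoˡ-≤ t K<x))
... | no m+ℓ≰2[m∸x] = ≤-trans
      (C-large-column {t} {ℓ} {c₀} ℓ<t (≤-trans t≤K (<⇒≤ K<x)) m≤4x 0<c₀ (≤-trans (m≤m+n _ (2 * ℓ)) big))
      (m≤m*n (x C t) ((m ∸ x) C ℓ) {{>-nonZero (C-pos ℓ≤m∸x)}})
  where
  m≤4x : m ≤ 4 * x
  m≤4x = ≮half⇒≤4* (≤-trans (m≤m+n x ℓ) x+ℓ≤m) (≤-trans (m≤n+m (2 * ℓ) ((4 * t) ^ t * t ^ t * c₀)) big) (≰⇒> m+ℓ≰2[m∸x])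
  ℓ≤m∸x : ℓ ≤ m ∸ x
  ℓ≤m∸x = m+n≤o⇒m≤o∸n ℓ (≤-trans (≤-reflexive (+-comm ℓ x)) x+ℓ≤m)

size-partition : ∀ t {K} x → t ≤ x → suc t ≤ K →
  ind (x ≡ᵇ t) + ind (x ≡ᵇ suc t) + ind ((2 + t ≤ᵇ x) ∧ (x ≤ᵇ K)) ≡ ind (x ≤ᵇ K)
size-partition zero zero _ (s≤s _) = refl
size-partition zero (suc zero) _ (s≤s _) = refl
size-partition zero (suc (suc x)) _ _ = refl
size-partition (suc t) {suc K} (suc x) (s≤s t≤x) (s≤s t+1≤K)
  rewrite <ᵇ-suc (2 + t) x | <ᵇ-suc x K = size-partition t x t≤x t+1≤K

not-good-bound : ∀ lam a b → a ≤ 1 → a + b ≤ suc lam →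
  ind (not ((a ≡ᵇ 1) ∧ (b ≡ᵇ lam))) + 2 * a + b ≤ 2 + lam
not-good-bound lam zero b _ a+b≤ = s≤s a+b≤
not-good-bound lam (suc zero) b _ (s≤s b≤lam) with b ≡ᵇ lam in e
... | true = ≤-reflexive (cong (2 +_) (≡ᵇ⇒≡ b lam (T-from-≡ e)))
... | false = s≤s (s≤s (≤∧≢⇒< b≤lam λ b≡lam → subst T e (≡⇒≡ᵇ b lam b≡lam)))
not-good-bound lam (suc (suc a)) b (s≤s ()) _

module _ (t lam N a b c d : ℕ) (many-columns : (suc t + lam) * N < suc t * (a + b + c + d)) (a≤N : a ≤ N) where

  mid<heavy : a + suc t * b + (2 + t) * c ≤ suc lam * N → c < suc t * d
  mid<heavy light = +-cancelˡ-≤ (t * N) _ _ (≤-trans sum (+-monoˡ-≤ (suc t * d) (*-monoʳ-≤ t a≤N)))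
    where
    sum : t * N + suc c ≤ t * a + suc t * d
    sum = +-cancelʳ-≤ (suc lam * N + a + suc t * b + suc t * c) _ _
            (subst₂ _≤_ (lhs t lam N a b c) (rhs t lam N a b c d) (+-mono-≤ many-columns light))
      where
      lhs : ∀ t lam N a b c → suc ((suc t + lam) * N) + (a + suc t * b + (2 + t) * c)
                              ≡ t * N + suc c + (suc lam * N + a + suc t * b + suc t * c)
      lhs = solve-∀
      rhs : ∀ t lam N a b c d → suc t * (a + b + c + d) + suc lam * N
                                ≡ t * a + suc t * d + (suc lam * N + a + suc t * b + suc t * c)
      rhs = solve-∀

  not-good<mid+heavy : ∀ B → B + 2 * a + suc t * b ≤ (2 + lam) * N → 1 ≤ t → B < suc t * (c + d)
  not-good<mid+heavy B bad (s≤s {n = t′} z≤n) =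
    +-cancelˡ-≤ (t′ * N) _ _ (≤-trans sum (+-monoˡ-≤ (suc t * (c + d)) (*-monoʳ-≤ t′ a≤N)))
    where
    sum : t′ * N + suc B ≤ t′ * a + suc t * (c + d)
    sum = +-cancelʳ-≤ ((2 + lam) * N + 2 * a + suc t * b) _ _
            (subst₂ _≤_ (lhs t′ lam N a b B) (rhs t′ lam N a b c d) (+-mono-≤ many-columns bad))
      where
      lhs : ∀ t′ lam N a b B → suc ((2 + t′ + lam) * N) + (B + 2 * a + (2 + t′) * b)
                               ≡ t′ * N + suc B + ((2 + lam) * N + 2 * a + (2 + t′) * b)
      lhs = solve-∀
      rhs : ∀ t′ lam N a b c d → (2 + t′) * (a + b + c + d) + (2 + lam) * N
                                 ≡ t′ * a + (2 + t′) * (c + d) + ((2 + lam) * N + 2 * a + (2 + t′) * b)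
      rhs = solve-∀

<-chain : ∀ s B c d → c < s * d → B < s * (c + d) → B < s * suc s * d
<-chain s B c d c<sd B<s[c+d] = begin-strict
  B               <⟨ B<s[c+d] ⟩
  s * (c + d)     ≤⟨ *-monoʳ-≤ s (+-monoˡ-≤ d (<⇒≤ c<sd)) ⟩
  s * (s * d + d) ≡⟨ regroup s d ⟩
  s * suc s * d   ∎
  where
  open ≤-Reasoning
  regroup : ∀ s d → s * (s * d + d) ≡ s * suc s * d
  regroup = solve-∀

halves⇒< : ∀ {W B G N} → 2 * W ≤ N → 2 * suc B ≤ N → G + B ≡ N → W < G
halves⇒< {W} {B} {G} {N} 2W≤N 2[1+B]≤N G+B≡N = *-cancelˡ-≤ 2 (+-cancelʳ-≤ (2 * B) _ _ (begin
  2 * suc W + 2 * B   ≡⟨ regroup W B ⟩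
  2 * W + 2 * suc B   ≤⟨ +-mono-≤ 2W≤N 2[1+B]≤N ⟩
  N + N               ≡⟨ cong (λ x → x + x) (sym G+B≡N) ⟩
  (G + B) + (G + B)   ≡⟨ regroup′ G B ⟩
  2 * G + 2 * B       ∎))
  where
  open ≤-Reasoning
  regroup : ∀ W B → 2 * suc W + 2 * B ≡ 2 * W + 2 * suc B
  regroup = solve-∀
  regroup′ : ∀ G B → (G + B) + (G + B) ≡ 2 * G + 2 * B
  regroup′ = solve-∀

-- Chosen so that the pairs (S, L) in heavy columns give 2(t+1)(t+2)·#Heavy ≤ C(m,t).
heavy-weight : ℕ → ℕ → ℕ
heavy-weight t lam = suc lam * (2 * (suc t * (2 + t)))

module Counting (t′ ℓ lam K : ℕ) {m n : ℕ} (A : Matrix m n)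
  (no-config : ¬ (copies1t0l (lam + 2) (suc t′) ℓ ≺ A))
  (sizes : ∀ j → suc t′ ≤ colSum A j × colSum A j ≤ m ∸ ℓ)
  (simple : ∀ j j′ → colSum A j ≡ suc t′ → colSum A j′ ≡ suc t′ → I A j ≡ I A j′ → j ≡ j′)
  (t+1≤K : suc (suc t′) ≤ K)
  (room : (2 + lam) * K + ℓ ≤ m) where

  t : ℕ
  t = suc t′

  open ForbiddenConfiguration t ℓ lam A no-config

  k : Fin n → ℕ
  k = colSum A

  isT isT+1 isMid isLight isHeavy : Fin n → Bool
  isT j = k j ≡ᵇ t
  isT+1 j = k j ≡ᵇ suc t
  isMid j = (2 + t ≤ᵇ k j) ∧ (k j ≤ᵇ K)
  isLight j = k j ≤ᵇ K
  isHeavy j = not (isLight j)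

  #T #T+1 #Mid #Heavy #tsets : ℕ
  #T = countFin n isT
  #T+1 = countFin n isT+1
  #Mid = countFin n isMid
  #Heavy = countFin n isHeavy
  #tsets = m C t

  -- For a t-set S, deg isT S is μ(S) and deg isT+1 S is d(S).
  deg : (Fin n → Bool) → Subset m → ℕ
  deg P S = countFin n (λ j → P j ∧ S ⊆ᵇ I A j)

  light-partition : ∀ j → ind (isT j) + ind (isT+1 j) + ind (isMid j) ≡ ind (isLight j)
  light-partition j = size-partition t (k j) (proj₁ (sizes j)) t+1≤K

  #columns : #T + #T+1 + #Mid + #Heavy ≡ n
  #columns = begin
    #T + #T+1 + #Mid + #Heavy
      ≡⟨ cong (λ x → x + #Mid + #Heavy) (sym (sumFin-+ n _ _)) ⟩
    sumFin n (λ j → ind (isT j) + ind (isT+1 j)) + #Mid + #Heavy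
      ≡⟨ cong (_+ #Heavy) (sym (sumFin-+ n _ _)) ⟩
    sumFin n (λ j → ind (isT j) + ind (isT+1 j) + ind (isMid j)) + #Heavy
      ≡⟨ sym (sumFin-+ n _ _) ⟩
    sumFin n (λ j → ind (isT j) + ind (isT+1 j) + ind (isMid j) + ind (isHeavy j))
      ≡⟨ sumFin-cong n (λ j → trans (cong (_+ ind (isHeavy j)) (light-partition j)) (ind-+-not (isLight j))) ⟩
    sumFin n (λ _ → 1)
      ≡⟨ sumFin-1 n ⟩
    n ∎
    where open ≡-Reasoning

  sum-deg : ∀ P → sumOfSize m t (deg P) ≡ sumFin n (λ j → ind (P j) * (k j C t))
  sum-deg P = begin
    sumOfSize m t (deg P)
      ≡⟨ sumOfSize-sumFin n (λ S j → ind (P j ∧ S ⊆ᵇ I A j)) ⟩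
    sumFin n (λ j → sumOfSize m t (λ S → ind (P j ∧ S ⊆ᵇ I A j)))
      ≡⟨ sumFin-cong n (λ j → trans (sumOfSize-cong {m} {t} (λ S _ → ind-∧ (P j) (S ⊆ᵇ I A j)))
                                    (sumOfSize-*ˡ {m} {t} (ind (P j)) _)) ⟩
    sumFin n (λ j → ind (P j) * sumOfSize m t (λ S → ind (S ⊆ᵇ I A j)))
      ≡⟨ sumFin-cong n (λ j → cong (ind (P j) *_) (sumOfSize-⊆ᵇ (I A j) t)) ⟩
    sumFin n (λ j → ind (P j) * (k j C t)) ∎
    where open ≡-Reasoning

  sum-deg-T : sumOfSize m t (deg isT) ≡ #T
  sum-deg-T = trans (sum-deg isT) (sumFin-cong n λ j →
    trans (ind-≡ᵇ-subst (k j) t (_C t)) (trans (cong (ind (isT j) *_) (nCn≡1 t)) (*-identityʳ _)))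

  sum-deg-T+1 : sumOfSize m t (deg isT+1) ≡ suc t * #T+1
  sum-deg-T+1 = trans (sum-deg isT+1) (trans (sumFin-cong n λ j →
    trans (ind-≡ᵇ-subst (k j) (suc t) (_C t)) (trans (cong (ind (isT+1 j) *_) ([1+t]Ct≡1+t t))
                                                    (*-comm (ind (isT+1 j)) (suc t))))
    (sumFin-*ˡ n (suc t) _))

  sum-deg-Mid : (2 + t) * #Mid ≤ sumOfSize m t (deg isMid)
  sum-deg-Mid = begin
    (2 + t) * #Mid                          ≡⟨ sym (sumFin-*ˡ n (2 + t) _) ⟩
    sumFin n (λ j → (2 + t) * ind (isMid j)) ≤⟨ sumFin-mono n pointwise ⟩
    sumFin n (λ j → ind (isMid j) * (k j C t)) ≡⟨ sym (sum-deg isMid) ⟩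
    sumOfSize m t (deg isMid)               ∎
    where
    open ≤-Reasoning
    pointwise : ∀ j → (2 + t) * ind (isMid j) ≤ ind (isMid j) * (k j C t)
    pointwise j with 2 + t ≤ᵇ k j in e | k j ≤ᵇ K
    ... | false | _ = ≤-reflexive (*-zeroʳ (2 + t))
    ... | true | false = ≤-reflexive (*-zeroʳ (2 + t))
    ... | true | true = subst₂ _≤_ (sym (*-identityʳ _)) (sym (+-identityʳ _))
                          (≤-trans (3+t≤[3+t]C[1+t] t′) (C-monoˡ-≤ t (≤ᵇ⇒≤ (2 + t) (k j) (T-from-≡ e))))

  deg-light : ∀ {S} → ∣ S ∣ ≡ t → deg isT S + deg isT+1 S + deg isMid S ≤ suc lam
  deg-light {S} ∣S∣≡t = subst (_≤ suc lam) (sym split) (light-columns-⊇ K {S} ∣S∣≡t room)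
    where
    split : deg isT S + deg isT+1 S + deg isMid S ≡ countFin n (λ j → isLight j ∧ S ⊆ᵇ I A j)
    split = trans (cong (_+ deg isMid S) (sym (sumFin-+ n _ _))) (trans (sym (sumFin-+ n _ _))
      (sumFin-cong n λ j → begin
        ind (isT j ∧ s j) + ind (isT+1 j ∧ s j) + ind (isMid j ∧ s j)
          ≡⟨ cong₂ _+_ (cong₂ _+_ (ind-∧ (isT j) (s j)) (ind-∧ (isT+1 j) (s j))) (ind-∧ (isMid j) (s j)) ⟩
        ind (isT j) * ind (s j) + ind (isT+1 j) * ind (s j) + ind (isMid j) * ind (s j)
          ≡⟨ distrib (ind (isT j)) (ind (isT+1 j)) (ind (isMid j)) (ind (s j)) ⟩
        (ind (isT j) + ind (isT+1 j) + ind (isMid j)) * ind (s j)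
          ≡⟨ cong (_* ind (s j)) (light-partition j) ⟩
        ind (isLight j) * ind (s j)
          ≡⟨ sym (ind-∧ (isLight j) (s j)) ⟩
        ind (isLight j ∧ s j) ∎))
      where
      open ≡-Reasoning
      s : Fin n → Bool
      s j = S ⊆ᵇ I A j
      distrib : ∀ a b c x → a * x + b * x + c * x ≡ (a + b + c) * x
      distrib = solve-∀

  deg-T≤1 : ∀ {S} → ∣ S ∣ ≡ t → deg isT S ≤ 1
  deg-T≤1 {S} ∣S∣≡t = ¬injection⇒countFin≤ n _ 1 λ (c , Pc , c-inj) →
    contradiction (c-inj (simple (c zero) (c (suc zero)) (size (Pc zero)) (size (Pc (suc zero)))
                                 (trans (sym (S≡I (Pc zero))) (S≡I (Pc (suc zero)))))) λ ()
    where
    size : ∀ {j} → T (isT j ∧ S ⊆ᵇ I A j) → k j ≡ t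
    size {j} Pj = ≡ᵇ⇒≡ (k j) t (proj₁ (T-∧⁻ Pj))
    S≡I : ∀ {j} → T (isT j ∧ S ⊆ᵇ I A j) → S ≡ I A j
    S≡I {j} Pj = ⊆∧∣≡∣⇒≡ (T-does⇒ (S ⊆? _) (proj₂ (T-∧⁻ {isT j} Pj))) (trans ∣S∣≡t (sym (size Pj)))

  #T≤#tsets : #T ≤ #tsets
  #T≤#tsets = begin
    #T                       ≡⟨ sym sum-deg-T ⟩
    sumOfSize m t (deg isT)  ≤⟨ sumOfSize-bound (deg isT) 1 (λ S → deg-T≤1 {S}) ⟩
    1 * #tsets               ≡⟨ *-identityˡ #tsets ⟩
    #tsets                   ∎
    where open ≤-Reasoning

  light-count : #T + suc t * #T+1 + (2 + t) * #Mid ≤ suc lam * #tsets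
  light-count = begin
    #T + suc t * #T+1 + (2 + t) * #Mid
      ≤⟨ +-monoʳ-≤ (#T + suc t * #T+1) sum-deg-Mid ⟩
    #T + suc t * #T+1 + sumOfSize m t (deg isMid)
      ≡⟨ sym (cong₂ (λ x y → x + y + sumOfSize m t (deg isMid)) sum-deg-T sum-deg-T+1) ⟩
    sumOfSize m t (deg isT) + sumOfSize m t (deg isT+1) + sumOfSize m t (deg isMid)
      ≡⟨ sym (trans (sumOfSize-+ _ (deg isMid))
                    (cong (_+ sumOfSize m t (deg isMid)) (sumOfSize-+ (deg isT) (deg isT+1)))) ⟩
    sumOfSize m t (λ S → deg isT S + deg isT+1 S + deg isMid S)
      ≤⟨ sumOfSize-bound _ (suc lam) (λ S → deg-light {S}) ⟩
    suc lam * #tsets ∎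
    where open ≤-Reasoning

  good : Subset m → Bool
  good S = (deg isT S ≡ᵇ 1) ∧ (deg isT+1 S ≡ᵇ lam)

  #Good #NotGood : ℕ
  #Good = sumOfSize m t (ind ∘ good)
  #NotGood = sumOfSize m t (λ S → ind (not (good S)))

  #Good+#NotGood : #Good + #NotGood ≡ #tsets
  #Good+#NotGood = trans (sym (sumOfSize-+ {m} {t} (ind ∘ good) (λ S → ind (not (good S)))))
    (trans (sumOfSize-cong {m} {t} (λ S _ → ind-+-not (good S))) (sumOfSize-1 m t))

  not-good-count : #NotGood + 2 * #T + suc t * #T+1 ≤ (2 + lam) * #tsets
  not-good-count = begin
    #NotGood + 2 * #T + suc t * #T+1
      ≡⟨ sym (cong₂ (λ x y → #NotGood + 2 * x + y) sum-deg-T sum-deg-T+1) ⟩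
    #NotGood + 2 * sumOfSize m t (deg isT) + sumOfSize m t (deg isT+1)
      ≡⟨ cong (λ x → #NotGood + x + sumOfSize m t (deg isT+1)) (sym (sumOfSize-*ˡ {m} {t} 2 (deg isT))) ⟩
    #NotGood + sumOfSize m t (λ S → 2 * deg isT S) + sumOfSize m t (deg isT+1)
      ≡⟨ sym (trans (sumOfSize-+ {m} {t} _ (deg isT+1))
                    (cong (_+ sumOfSize m t (deg isT+1)) (sumOfSize-+ {m} {t} (ind ∘ not ∘ good) (λ S → 2 * deg isT S)))) ⟩
    sumOfSize m t (λ S → ind (not (good S)) + 2 * deg isT S + deg isT+1 S)
      ≤⟨ sumOfSize-bound _ (2 + lam) (λ S ∣S∣≡t →
           not-good-bound lam _ _ (deg-T≤1 {S} ∣S∣≡t) (≤-trans (m≤m+n _ (deg isMid S)) (deg-light {S} ∣S∣≡t))) ⟩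
    (2 + lam) * #tsets ∎
    where open ≤-Reasoning

  module Heavy (ℓ<t : ℓ < t) (c₀-fits : 2 ^ ℓ * heavy-weight t lam ≤ suc K C t)
    (big : (4 * t) ^ t * t ^ t * heavy-weight t lam + 2 * ℓ ≤ m) where

    c₀ : ℕ
    c₀ = heavy-weight t lam

    ℓ≤m : ℓ ≤ m
    ℓ≤m = ≤-trans (m≤n+m ℓ _) room

    covers : Fin n → Subset m → Subset m → Bool
    covers j S L = isHeavy j ∧ (S ⊆ᵇ I A j ∧ L ⊆ᵇ ∁ (I A j))

    #pairs : ℕ
    #pairs = sumOfSize m t (λ S → sumOfSize m ℓ (λ L → countFin n (λ j → covers j S L)))

    #pairs-≤ : #pairs ≤ suc lam * (m C ℓ) * #tsets
    #pairs-≤ = sumOfSize-bound _ _ λ S ∣S∣≡t →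
      sumOfSize-bound _ (suc lam) λ L ∣L∣≡ℓ → columns-⊇-⊆∁ isHeavy {S} {L} ∣S∣≡t ∣L∣≡ℓ

    pairs-in-column : ∀ j →
      sumOfSize m t (λ S → sumOfSize m ℓ (ind ∘ covers j S)) ≡ ind (isHeavy j) * ((k j C t) * ((m ∸ k j) C ℓ))
    pairs-in-column j = begin
      sumOfSize m t (λ S → sumOfSize m ℓ (ind ∘ covers j S))
        ≡⟨ sumOfSize-cong {m} {t} (λ S _ → sumOfSize-cong {m} {ℓ} λ L _ → reassoc h (s S) (l L)) ⟩
      sumOfSize m t (λ S → sumOfSize m ℓ (λ L → (ind h * ind (s S)) * ind (l L)))
        ≡⟨ sumOfSize-* (λ S → ind h * ind (s S)) (ind ∘ l) ⟩
      sumOfSize m t (λ S → ind h * ind (s S)) * sumOfSize m ℓ (ind ∘ l)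
        ≡⟨ cong₂ _*_ (trans (sumOfSize-*ˡ {m} {t} (ind h) (ind ∘ s)) (cong (ind h *_) (sumOfSize-⊆ᵇ (I A j) t)))
                     (trans (sumOfSize-⊆ᵇ (∁ (I A j)) ℓ) (cong (_C ℓ) (∣∁p∣≡n∸∣p∣ (I A j)))) ⟩
      ind h * (k j C t) * ((m ∸ k j) C ℓ)
        ≡⟨ *-assoc (ind h) _ _ ⟩
      ind h * ((k j C t) * ((m ∸ k j) C ℓ)) ∎
      where
      open ≡-Reasoning
      h = isHeavy j
      s l : Subset m → Bool
      s S = S ⊆ᵇ I A j
      l L = L ⊆ᵇ ∁ (I A j)
      reassoc : ∀ a b c → ind (a ∧ (b ∧ c)) ≡ (ind a * ind b) * ind c
      reassoc a b c = trans (ind-∧ a (b ∧ c)) (trans (cong (ind a *_) (ind-∧ b c)) (sym (*-assoc (ind a) _ _)))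

    #pairs-≡ : #pairs ≡ sumFin n (λ j → ind (isHeavy j) * ((k j C t) * ((m ∸ k j) C ℓ)))
    #pairs-≡ = begin
      #pairs
        ≡⟨ sumOfSize-cong {m} {t} (λ S _ → sumOfSize-sumFin {m} {ℓ} n _) ⟩
      sumOfSize m t (λ S → sumFin n (λ j → sumOfSize m ℓ (ind ∘ covers j S)))
        ≡⟨ sumOfSize-sumFin {m} {t} n _ ⟩
      sumFin n (λ j → sumOfSize m t (λ S → sumOfSize m ℓ (ind ∘ covers j S)))
        ≡⟨ sumFin-cong n pairs-in-column ⟩
      sumFin n (λ j → ind (isHeavy j) * ((k j C t) * ((m ∸ k j) C ℓ))) ∎
      where open ≡-Reasoning

    heavy-column : ∀ j → ind (isHeavy j) * (c₀ * (m C ℓ)) ≤ ind (isHeavy j) * ((k j C t) * ((m ∸ k j) C ℓ))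
    heavy-column j with k j ≤ᵇ K in e
    ... | true = z≤n
    ... | false = *-monoʳ-≤ 1 (heavy-column-weight ℓ<t (≤-trans (n≤1+n t) t+1≤K) (s≤s z≤n) c₀-fits big
                    (≰⇒> λ k≤K → subst T e (≤⇒≤ᵇ k≤K)) (m≤o∸n⇒m+n≤o (k j) ℓ≤m (proj₂ (sizes j))))

    heavy-count : 2 * (suc t * (2 + t)) * #Heavy ≤ #tsets
    heavy-count = *-cancelˡ-≤ (suc lam) (*-cancelˡ-≤ (m C ℓ) {{>-nonZero (C-pos ℓ≤m)}} (begin
      (m C ℓ) * (suc lam * (2 * (suc t * (2 + t)) * #Heavy)) ≡⟨ regroup (m C ℓ) (suc lam) (2 * (suc t * (2 + t))) #Heavy ⟩
      (c₀ * (m C ℓ)) * #Heavy                               ≡⟨ sym (sumFin-*ˡ n (c₀ * (m C ℓ)) _) ⟩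
      sumFin n (λ j → (c₀ * (m C ℓ)) * ind (isHeavy j))     ≡⟨ sumFin-cong n (λ j → *-comm (c₀ * (m C ℓ)) _) ⟩
      sumFin n (λ j → ind (isHeavy j) * (c₀ * (m C ℓ)))     ≤⟨ sumFin-mono n heavy-column ⟩
      sumFin n (λ j → ind (isHeavy j) * ((k j C t) * ((m ∸ k j) C ℓ))) ≡⟨ sym #pairs-≡ ⟩
      #pairs                                               ≤⟨ #pairs-≤ ⟩
      suc lam * (m C ℓ) * #tsets                           ≡⟨ regroup′ (suc lam) (m C ℓ) #tsets ⟩
      (m C ℓ) * (suc lam * #tsets)                         ∎))
      where
      open ≤-Reasoning
      regroup : ∀ a b c d → a * (b * (c * d)) ≡ b * c * a * d
      regroup = solve-∀
      regroup′ : ∀ a b c → a * b * c ≡ b * (a * c)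
      regroup′ = solve-∀

  0<m : 0 < m
  0<m = ≤-trans (≤-trans (s≤s z≤n) t+1≤K) (≤-trans (m≤n*m K (2 + lam)) (≤-trans (m≤m+n _ ℓ) room))

  module Neighbourhood {ρ} (R : Subset m) (∣R∣≡ρ : ∣ R ∣ ≡ ρ)
    (m-large : 2 * t * (ρ * (suc t * suc lam)) ≤ m) where

    through : Fin m → Fin n → Bool
    through r j = isT+1 j ∧ A r j

    -- Only S ⊆ I(α) is required, so this over-approximates W_R; the upper bound is all we need.
    inW : Subset m → Bool
    inW S = anyFin m (λ r → r ∈ᵇ R ∧ anyFin n (λ j → through r j ∧ S ⊆ᵇ I A j))

    #W : ℕ
    #W = sumOfSize m t (ind ∘ inW)

    [m∸1]C[t∸1] : ℕ
    [m∸1]C[t∸1] = (m ∸ 1) C t′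

    inW-≤ : ∀ S → ind (inW S) ≤ sumFin m (λ r → ind (r ∈ᵇ R) * deg (through r) S)
    inW-≤ S = ≤-trans (ind-anyFin≤ m _) (sumFin-mono m λ r →
      ≤-trans (≤-reflexive (ind-∧ (r ∈ᵇ R) _)) (*-monoʳ-≤ (ind (r ∈ᵇ R)) (ind-anyFin≤ n _)))

    sum-deg-through : ∀ r → sumOfSize m t (deg (through r)) ≡ suc t * countFin n (through r)
    sum-deg-through r = trans (sum-deg (through r)) (trans (sumFin-cong n pointwise) (sumFin-*ˡ n (suc t) _))
      where
      pointwise : ∀ j → ind (through r j) * (k j C t) ≡ suc t * ind (through r j)
      pointwise j = begin
        ind (isT+1 j ∧ A r j) * (k j C t)         ≡⟨ cong (_* (k j C t)) (ind-∧ (isT+1 j) (A r j)) ⟩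
        ind (isT+1 j) * ind (A r j) * (k j C t)   ≡⟨ swap (ind (isT+1 j)) (ind (A r j)) (k j C t) ⟩
        ind (A r j) * (ind (isT+1 j) * (k j C t)) ≡⟨ cong (ind (A r j) *_) (ind-≡ᵇ-subst (k j) (suc t) (_C t)) ⟩
        ind (A r j) * (ind (isT+1 j) * (suc t C t)) ≡⟨ cong (λ x → ind (A r j) * (ind (isT+1 j) * x)) ([1+t]Ct≡1+t t) ⟩
        ind (A r j) * (ind (isT+1 j) * suc t)     ≡⟨ swap′ (ind (A r j)) (ind (isT+1 j)) (suc t) ⟩
        suc t * (ind (isT+1 j) * ind (A r j))     ≡⟨ cong (suc t *_) (sym (ind-∧ (isT+1 j) (A r j))) ⟩
        suc t * ind (isT+1 j ∧ A r j)             ∎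
        where
        open ≡-Reasoning
        swap : ∀ a b c → a * b * c ≡ b * (a * c)
        swap = solve-∀
        swap′ : ∀ a b c → a * (b * c) ≡ c * (b * a)
        swap′ = solve-∀

    through-⊇ : ∀ r {S} → ∣ S ∣ ≡ t → sumFin n (λ j → ind (through r j) * ind (S ⊆ᵇ I A j)) ≤ suc lam
    through-⊇ r {S} ∣S∣≡t = begin
      sumFin n (λ j → ind (through r j) * ind (S ⊆ᵇ I A j)) ≤⟨ sumFin-mono n (λ j → ind-∧-*-≤ (isT+1 j) (A r j) _) ⟩
      deg isT+1 S                                         ≤⟨ m≤n+m _ (deg isT S) ⟩
      deg isT S + deg isT+1 S                             ≤⟨ m≤m+n _ (deg isMid S) ⟩
      deg isT S + deg isT+1 S + deg isMid S               ≤⟨ deg-light {S} ∣S∣≡t ⟩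
      suc lam                                             ∎
      where open ≤-Reasoning

    tsets-through : Fin m → Fin n → ℕ
    tsets-through r j = sumOfSize m t (λ S → ind (r ∈ᵇ S) * ind (S ⊆ᵇ I A j))

    one-≤-tsets-through : ∀ r j → ind (through r j) ≤ ind (through r j) * tsets-through r j
    one-≤-tsets-through r j with isT+1 j in e₁ | A r j in e₂
    ... | false | _ = z≤n
    ... | true | false = z≤n
    ... | true | true = begin
      1                   ≤⟨ s≤s z≤n ⟩
      suc t′              ≡⟨ sym ([1+t]Ct≡1+t t′) ⟩
      t C t′              ≡⟨ cong (λ x → (x ∸ 1) C t′) (sym (≡ᵇ⇒≡ (k j) (suc t) (T-from-≡ e₁))) ⟩
      (k j ∸ 1) C t′      ≡⟨ sym (sumOfSize-∈ᵇ-⊆ᵇ (true⇒∈I A e₂) t′) ⟩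
      tsets-through r j   ≡⟨ sym (+-identityʳ _) ⟩
      1 * tsets-through r j ∎
      where open ≤-Reasoning

    through-count : ∀ r → countFin n (through r) ≤ suc lam * [m∸1]C[t∸1]
    through-count r = begin
      countFin n (through r)
        ≤⟨ sumFin-mono n (one-≤-tsets-through r) ⟩
      sumFin n (λ j → ind (through r j) * tsets-through r j)
        ≡⟨ sumFin-cong n (λ j → sym (sumOfSize-*ˡ {m} {t} (ind (through r j)) _)) ⟩
      sumFin n (λ j → sumOfSize m t (λ S → ind (through r j) * (ind (r ∈ᵇ S) * ind (S ⊆ᵇ I A j))))
        ≡⟨ sym (sumOfSize-sumFin {m} {t} n _) ⟩
      sumOfSize m t (λ S → sumFin n (λ j → ind (through r j) * (ind (r ∈ᵇ S) * ind (S ⊆ᵇ I A j))))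
        ≡⟨ sumOfSize-cong {m} {t} (λ S _ → trans (sumFin-cong n (λ j → swap (ind (through r j)) (ind (r ∈ᵇ S)) _))
                                                (sumFin-*ˡ n (ind (r ∈ᵇ S)) _)) ⟩
      sumOfSize m t (λ S → ind (r ∈ᵇ S) * sumFin n (λ j → ind (through r j) * ind (S ⊆ᵇ I A j)))
        ≤⟨ sumOfSize-≤ {m} {t} (λ S ∣S∣≡t → *-monoʳ-≤ (ind (r ∈ᵇ S)) (through-⊇ r {S} ∣S∣≡t)) ⟩
      sumOfSize m t (λ S → ind (r ∈ᵇ S) * suc lam)
        ≡⟨ trans (sumOfSize-cong {m} {t} (λ S _ → *-comm (ind (r ∈ᵇ S)) (suc lam)))
                 (sumOfSize-*ˡ {m} {t} (suc lam) _) ⟩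
      suc lam * sumOfSize m t (λ S → ind (r ∈ᵇ S))
        ≡⟨ cong (suc lam *_) (sumOfSize-∈ᵇ m r t′) ⟩
      suc lam * [m∸1]C[t∸1] ∎
      where
      open ≤-Reasoning
      swap : ∀ a b c → a * (b * c) ≡ b * (a * c)
      swap = solve-∀

    #W-≤ : #W ≤ ρ * (suc t * (suc lam * [m∸1]C[t∸1]))
    #W-≤ = begin
      #W
        ≤⟨ sumOfSize-≤ {m} {t} (λ S _ → inW-≤ S) ⟩
      sumOfSize m t (λ S → sumFin m (λ r → ind (r ∈ᵇ R) * deg (through r) S))
        ≡⟨ sumOfSize-sumFin {m} {t} m _ ⟩
      sumFin m (λ r → sumOfSize m t (λ S → ind (r ∈ᵇ R) * deg (through r) S))
        ≡⟨ sumFin-cong m (λ r → trans (sumOfSize-*ˡ {m} {t} (ind (r ∈ᵇ R)) _)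
                                      (cong (ind (r ∈ᵇ R) *_) (sum-deg-through r))) ⟩
      sumFin m (λ r → ind (r ∈ᵇ R) * (suc t * countFin n (through r)))
        ≤⟨ sumFin-mono m (λ r → *-monoʳ-≤ (ind (r ∈ᵇ R)) (*-monoʳ-≤ (suc t) (through-count r))) ⟩
      sumFin m (λ r → ind (r ∈ᵇ R) * (suc t * (suc lam * [m∸1]C[t∸1])))
        ≡⟨ trans (sumFin-cong m (λ r → *-comm (ind (r ∈ᵇ R)) _))
                 (sumFin-*ˡ m (suc t * (suc lam * [m∸1]C[t∸1])) (ind ∘ (_∈ᵇ R))) ⟩
      suc t * (suc lam * [m∸1]C[t∸1]) * countFin m (_∈ᵇ R)
        ≡⟨ cong (suc t * (suc lam * [m∸1]C[t∸1]) *_) (trans (sym (∣p∣≡countFin∈ᵇ R)) ∣R∣≡ρ) ⟩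
      suc t * (suc lam * [m∸1]C[t∸1]) * ρ
        ≡⟨ *-comm _ ρ ⟩
      ρ * (suc t * (suc lam * [m∸1]C[t∸1])) ∎
      where open ≤-Reasoning

    2#W≤#tsets : 2 * #W ≤ #tsets
    2#W≤#tsets = *-cancelˡ-≤ t (begin
      t * (2 * #W)                                      ≤⟨ *-monoʳ-≤ t (*-monoʳ-≤ 2 #W-≤) ⟩
      t * (2 * (ρ * (suc t * (suc lam * [m∸1]C[t∸1])))) ≡⟨ regroup t ρ (suc t) (suc lam) [m∸1]C[t∸1] ⟩
      2 * t * (ρ * (suc t * suc lam)) * [m∸1]C[t∸1]     ≤⟨ *-monoˡ-≤ [m∸1]C[t∸1] m-large ⟩
      m * [m∸1]C[t∸1]                                   ≡⟨ sym (C-absorb′ t′ 0<m) ⟩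
      t * #tsets                                        ∎)
      where
      open ≤-Reasoning
      regroup : ∀ t ρ a b c → t * (2 * (ρ * (a * (b * c)))) ≡ 2 * t * (ρ * (a * b)) * c
      regroup = solve-∀

    InW⇒inW : ∀ {S} → InW A t R S → T (inW S)
    InW⇒inW {S} (_ , x , j , ∣Ij∣≡t+1 , (r , r∈R , Arj≡true) , S∪x≡Ij) =
      T-anyFin m _ r (T-∧⁺ (T-does⇐ (r ∈? R) r∈R) (T-anyFin n _ j
        (T-∧⁺ (T-∧⁺ (≡⇒≡ᵇ (k j) (suc t) ∣Ij∣≡t+1) (T-from-≡ Arj≡true))
              (T-does⇐ (S ⊆? I A j) (λ x∈S → subst (_ ∈_) S∪x≡Ij (p⊆p∪q ⁅ x ⁆ x∈S))))))

    good∧¬inW⇒InY∧¬InW : ∀ {S} → ∣ S ∣ ≡ t → ind (inW S) < ind (good S) → InY A t lam S × ¬ InW A t R S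
    good∧¬inW⇒InY∧¬InW {S} ∣S∣≡t lt with inW S in e-inW | good S in e-good
    ... | true | true = contradiction lt (n≮n 1)
    ... | false | true = (∣S∣≡t , d≡lam , μ) , λ S∈W → subst T e-inW (InW⇒inW S∈W)
      where
      degs = T-∧⁻ {deg isT S ≡ᵇ 1} (T-from-≡ e-good)
      d≡lam : d A t S ≡ lam
      d≡lam = trans (count-tabulate _ n (λ j → j)) (≡ᵇ⇒≡ (deg isT+1 S) lam (proj₂ degs))
      μ : μ1 A t S
      μ with ≤countFin⇒injection n _ 1 (≤-reflexive (sym (≡ᵇ⇒≡ (deg isT S) 1 (proj₁ degs))))
      ... | c , Pc , _ = c zero , ∣Ij∣≡t , sym (⊆∧∣≡∣⇒≡ S⊆Ij (trans ∣S∣≡t (sym ∣Ij∣≡t)))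
        where
        ∣Ij∣≡t = ≡ᵇ⇒≡ (k (c zero)) t (proj₁ (T-∧⁻ (Pc zero)))
        S⊆Ij = T-does⇒ (S ⊆? I A (c zero)) (proj₂ (T-∧⁻ {isT (c zero)} (Pc zero)))

    #W<#Good⇒∃ : #W < #Good → ∃ λ S → InY A t lam S × ¬ InW A t R S
    #W<#Good⇒∃ lt with sumOfSize-<⇒∃ (ind ∘ inW) (ind ∘ good) lt
    ... | S , ∣S∣≡t , inW<good = S , good∧¬inW⇒InY∧¬InW ∣S∣≡t inW<good

  good-outside-W : (suc t + lam) * #tsets < suc t * n →
    ℓ < t → 2 ^ ℓ * heavy-weight t lam ≤ suc K C t → (4 * t) ^ t * t ^ t * heavy-weight t lam + 2 * ℓ ≤ m →
    ∀ {ρ} (R : Subset m) → ∣ R ∣ ≡ ρ → 2 * t * (ρ * (suc t * suc lam)) ≤ m →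
    ∃ λ S → InY A t lam S × ¬ InW A t R S
  good-outside-W many ℓ<t c₀-fits big R ∣R∣≡ρ m-large =
    #W<#Good⇒∃ (halves⇒< 2#W≤#tsets 2[1+#NotGood]≤#tsets #Good+#NotGood)
    where
    open Heavy ℓ<t c₀-fits big
    open Neighbourhood R ∣R∣≡ρ m-large
    many′ : (suc t + lam) * #tsets < suc t * (#T + #T+1 + #Mid + #Heavy)
    many′ = subst (λ x → (suc t + lam) * #tsets < suc t * x) (sym #columns) many
    #NotGood<heavy : #NotGood < suc t * suc (suc t) * #Heavy
    #NotGood<heavy = <-chain (suc t) #NotGood #Mid #Heavy
      (mid<heavy t lam #tsets #T #T+1 #Mid #Heavy many′ #T≤#tsets light-count)
      (not-good<mid+heavy t lam #tsets #T #T+1 #Mid #Heavy many′ #T≤#tsets #NotGood not-good-count (s≤s z≤n))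
    2[1+#NotGood]≤#tsets : 2 * suc #NotGood ≤ #tsets
    2[1+#NotGood]≤#tsets = ≤-trans (*-monoʳ-≤ 2 #NotGood<heavy)
      (≤-trans (≤-reflexive (sym (*-assoc 2 (suc t * suc (suc t)) #Heavy))) heavy-count)

lemma7 : (t ℓ lam ρ : ℕ) → ℓ < t → 1 ≤ lam → 1 ≤ ρ →
    ∃ λ M → ∀ m → M ≤ m → ∀ n (A : Matrix m n) →
      ¬ (copies1t0l (lam + 2) t ℓ ≺ A) →
      (∀ j → t ≤ colSum A j × colSum A j ≤ m ∸ ℓ) →
      (∀ j j′ → colSum A j ≡ t → colSum A j′ ≡ t → I A j ≡ I A j′ → j ≡ j′) →
      (suc t + lam) * (m C t) < suc t * n →
      ∀ (R : Subset m) → ∣ R ∣ ≡ ρ →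
      ∃ λ (S : Subset m) → InY A t lam S × ¬ InW A t R S
lemma7 zero ℓ lam ρ () _ _
lemma7 t@(suc t′) ℓ lam ρ ℓ<t _ _ = M₁ + M₂ + M₃ , λ m M≤m n A no-config sizes simple many R ∣R∣≡ρ →
  Counting.good-outside-W t′ ℓ lam K A no-config sizes simple t+1≤K (≤-trans M₁≤M M≤m)
    many ℓ<t c₀-fits (≤-trans M₂≤M M≤m) R ∣R∣≡ρ (≤-trans (m≤n+m M₃ (M₁ + M₂)) M≤m)
  where
  c₀ = heavy-weight t lam
  a = t ^ t * (2 ^ ℓ * c₀) + 2
  K = a + t′
  t+1≤K : suc t ≤ K
  t+1≤K = +-monoˡ-≤ t′ (m≤n+m 2 _)
  c₀-fits : 2 ^ ℓ * c₀ ≤ suc K C t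
  c₀-fits = *-cancelˡ-≤ (t ^ t) {{>-nonZero (m^n>0 t t)}} (begin
    t ^ t * (2 ^ ℓ * c₀)  ≤⟨ ≤-trans (m≤m+n _ 2) (n≤1+n a) ⟩
    suc a                 ≤⟨ m≤m*n (suc a) (suc a ^ t′) {{>-nonZero (m^n>0 (suc a) t′)}} ⟩
    suc a ^ t             ≤⟨ ^≤^*C a t ⟩
    t ^ t * ((a + t) C t) ≡⟨ cong (λ x → t ^ t * (x C t)) (+-suc a t′) ⟩
    t ^ t * (suc K C t)   ∎)
    where open ≤-Reasoning
  M₁ = (2 + lam) * K + ℓ
  M₂ = (4 * t) ^ t * t ^ t * c₀ + 2 * ℓ
  M₃ = 2 * t * (ρ * (suc t * suc lam))
  M₁≤M : M₁ ≤ M₁ + M₂ + M₃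
  M₁≤M = ≤-trans (m≤m+n M₁ M₂) (m≤m+n _ M₃)
  M₂≤M : M₂ ≤ M₁ + M₂ + M₃
  M₂≤M = ≤-trans (m≤n+m M₂ M₁) (m≤m+n _ M₃)
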